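{- Let $E=\{0,1,\dots,n\}$ and let $M$ be a simple perfect matroid design of rank $r+1$ on $E$ with flat sizes $1=n_1<n_2<\dots<n_r$. Set $n_0=0$ and $n_{r+1}=n+1$. Then for $1\le i\le r$, in $A^*(M)$, \[\gamma_{n_i}^2=\frac{n_i-n_{i-1}}{n_{i+1}-n_{i-1}}\gamma_{n_i}\gamma_{n_{i+1}}+\frac{n_{i+1}-n_i}{n_{i+1}-n_{i-1}}\gamma_{n_{i-1}}\gamma_{n_i}.\]
   Context: A simple perfect matroid design of rank $r+1$ on $E$ is a simple matroid for which there are integers $1=n_1<n_2<\dots<n_r$ such that every flat of rank $j$ has exactly $n_j$ elements ($1\le j\le r$). The Chow ring $A^*(M)$ (real coefficients) is $\mathbb{R}[x_F : F \text{ a nonempty proper flat of } M]$ modulo the ideal generated by all $x_{F_1}x_{F_2}$ with $F_1,F_2$ incomparable and all $\sum_{F\ni i}x_F-\sum_{F\ni j}x_F$ for $i,j\in E$. For $S\subseteq E$, $x_S$ means the generator if $S$ is a nonempty proper flat and $0$ otherwise. Hypersimplex classes: $\gamma_k=\sum_S\left(\min(|S|,k)-\frac{k}{n+1}|S|\right)x_S$ for $1\le k\le n$ (sum over nonempty proper $S\subsetneq E$), and $\gamma_k=0$ for $k\le0$ or $k\ge n+1$. -}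

module Defs where

open import Data.Nat as ℕ using (ℕ; zero; suc; _≤_; _<_; _⊓_; _≡ᵇ_)
open import Data.Bool as Bool using (Bool; true; false; if_then_else_; _∧_; _∨_; not)
open import Data.Fin using (Fin)
open import Data.Fin.Subset using (Subset; _∈_; _∉_; _⊆_; _∪_; _∩_; ⁅_⁆; ∣_∣; Nonempty; ⊤)
open import Data.Fin.Subset.Properties using (_∈?_; nonempty?)
open import Data.Vec using (Vec; []; _∷_)
open import Data.Vec.Properties using (≡-dec)
open import Data.List as List using (List; []; _∷_; _++_; map; concatMap; filter; length; foldr)
open import Data.Product using (Σ; ∃; _×_; _,_)
open import Data.Integer using (+_)
open import Data.Rational as ℚ using (ℚ; 0ℚ; 1ℚ)
open import Relation.Nullary using (¬_; does)
open import Relation.Binary.PropositionalEquality using (_≡_; _≢_)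

record Matroid (N : ℕ) : Set where
  field
    rk        : Subset N → ℕ
    rk-bound  : ∀ X → rk X ≤ ∣ X ∣
    rk-mono   : ∀ X Y → X ⊆ Y → rk X ≤ rk Y
    rk-submod : ∀ X Y → rk (X ∪ Y) ℕ.+ rk (X ∩ Y) ≤ rk X ℕ.+ rk Y

open Matroid public

rank : ∀ {N} → Matroid N → ℕ
rank M = rk M ⊤

IsFlat : ∀ {N} → Matroid N → Subset N → Set
IsFlat M F = ∀ e → e ∉ F → rk M F < rk M (F ∪ ⁅ e ⁆)

-- simple: every set of at most two elements is independent
-- (no loops: e = f case; no parallel pairs: e ≠ f case)
IsSimple : ∀ {N} → Matroid N → Set
IsSimple M = ∀ e f → rk M (⁅ e ⁆ ∪ ⁅ f ⁆) ≡ ∣ ⁅ e ⁆ ∪ ⁅ f ⁆ ∣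

NEPFlat : ∀ {N} → Matroid N → Subset N → Set
NEPFlat M F = IsFlat M F × Nonempty F × F ≢ ⊤

-- Polynomials over ℚ in variables x_S indexed by subsets S of Fin N.
-- A monomial is a list of variables (read as a multiset);
-- a polynomial is a formal sum of terms (coefficient , monomial).

Monomial : ℕ → Set
Monomial N = List (Subset N)

Poly : ℕ → Set
Poly N = List (ℚ × Monomial N)

allᵇ : ∀ {A : Set} → (A → Bool) → List A → Bool
allᵇ P [] = true
allᵇ P (x ∷ xs) = P x ∧ allᵇ P xs

count : ∀ {N} → Subset N → Monomial N → ℕ
count S m = length (filter (λ T → ≡-dec Bool._≟_ S T) m)

sameMon : ∀ {N} → Monomial N → Monomial N → Bool
sameMon m m' = allᵇ (λ S → count S m ≡ᵇ count S m') (m ++ m')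

coeff : ∀ {N} → Poly N → Monomial N → ℚ
coeff [] m = 0ℚ
coeff ((c , m') ∷ p) m = (if sameMon m m' then c else 0ℚ) ℚ.+ coeff p m

_≈ₚ_ : ∀ {N} → Poly N → Poly N → Set
p ≈ₚ q = ∀ m → coeff p m ≡ coeff q m

var : ∀ {N} → Subset N → Poly N
var S = (1ℚ , S ∷ []) ∷ []

_+ₚ_ : ∀ {N} → Poly N → Poly N → Poly N
p +ₚ q = p ++ q

scale : ∀ {N} → ℚ → Poly N → Poly N
scale a p = map (λ { (c , m) → (a ℚ.* c , m) }) p

_*ₚ_ : ∀ {N} → Poly N → Poly N → Poly N
p *ₚ q = concatMap (λ { (a , m) → map (λ { (b , m') → (a ℚ.* b , m ++ m') }) q }) p

_-ₚ_ : ∀ {N} → Poly N → Poly N → Poly N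
p -ₚ q = p +ₚ scale (ℚ.- 1ℚ) q

sumₚ : ∀ {N} → List (Poly N) → Poly N
sumₚ = foldr _+ₚ_ []

allSubsets : (N : ℕ) → List (Subset N)
allSubsets zero = [] ∷ []
allSubsets (suc N) = map (true ∷_) (allSubsets N) ++ map (false ∷_) (allSubsets N)

-- The Chow ring A*(M) = ℚ[x_S : S ⊆ E] / I, where I is generated by
--  * x_S for S not a nonempty proper flat  (so x_S = 0 for such S),
--  * x_F x_G for nonempty proper flats F, G that are incomparable,
--  * Σ_{S ∋ i} x_S − Σ_{S ∋ j} x_S for i, j ∈ E.
-- (Modulo the first family this is exactly the usual presentation
--  ℚ[x_F : F nonempty proper flat] / (incomparability + linear relations).)

data Gen {N : ℕ} (M : Matroid N) : Set where
  nonflat : (S : Subset N) → ¬ NEPFlat M S → Gen M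
  incomp  : (F G : Subset N) → NEPFlat M F → NEPFlat M G →
            ¬ (F ⊆ G) → ¬ (G ⊆ F) → Gen M
  linear  : (i j : Fin N) → Gen M

containing : ∀ {N} → Fin N → Poly N
containing {N} i = sumₚ (map var (filter (λ S → i ∈? S) (allSubsets N)))

genPoly : ∀ {N} {M : Matroid N} → Gen M → Poly N
genPoly (nonflat S _) = var S
genPoly (incomp F G _ _ _ _) = var F *ₚ var G
genPoly (linear i j) = containing i -ₚ containing j

InIdeal : ∀ {N} → Matroid N → Poly N → Set
InIdeal {N} M p =
  Σ (List (ℚ × Monomial N × Gen M)) λ cs →
    p ≈ₚ sumₚ (map (λ { (c , m , g) → ((c , m) ∷ []) *ₚ genPoly g }) cs)

ChowEq : ∀ {N} → Matroid N → Poly N → Poly N → Set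
ChowEq M p q = InIdeal M (p -ₚ q)

-- natural numbers as rationals, and a / b for b > 0 (b = 0 never used)
ℕtoℚ : ℕ → ℚ
ℕtoℚ a = + a ℚ./ 1

frac : ℕ → ℕ → ℚ
frac a zero = 0ℚ
frac a (suc b) = + a ℚ./ suc b

γ : (n k : ℕ) → Poly (suc n)
γ n k =
  if (k ≡ᵇ 0) ∨ (suc n ℕ.≤ᵇ k) then []
  else sumₚ (map (λ S → scale (ℕtoℚ (∣ S ∣ ⊓ k) ℚ.- frac (k ℕ.* ∣ S ∣) (suc n)) (var S))
                 (filter (λ S → nonempty? S) (filter (λ S → Relation.Nullary.¬? (≡-dec Bool._≟_ S ⊤)) (allSubsets (suc n)))))

-- Let m = n_{i-1}, k = n_i, p = n_{i+1}, α = (k - m)/(p - m), β = (p - k)/(p - m), and let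
-- c_K(s) = min(s, K) - K s/(n+1) be the coefficient of x_S (|S| = s) in γ_K. In a perfect
-- matroid design no nonempty proper flat has size strictly between m and k or between k and p,
-- and on sizes s ≤ m or s ≥ p the map K ↦ c_K(s) is affine on {m, k, p}. Hence, for flats
-- A ⊆ B, the coefficient of x_A x_B in γ_k² - α γ_k γ_p - β γ_m γ_k only involves flats of
-- size exactly k, and it agrees with the coefficient of the element
--   Σ_{|T| = k} Σ_{i ∈ T, j ∉ T} V x_T (Σ_{S ∋ i} x_S - Σ_{S ∋ j} x_S)
-- of the ideal, for a suitable constant V. The remaining quadratic monomials x_S x_T
-- (S or T not a flat, or S, T incomparable) are multiples of generators of the ideal.

module Submission where

open import Defs
open import Level using (0ℓ)
open import Data.Unit.Base using (tt)
open import Data.Empty using (⊥-elim)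
open import Data.Bool as Bool using (Bool; true; false; if_then_else_; _∧_; _∨_; not; T)
open import Data.Nat as ℕ using (ℕ; zero; suc; _≤_; _<_; _∸_; _⊓_; _≡ᵇ_; s≤s; z≤n)
import Data.Nat.Properties as ℕP
open import Data.Integer as ℤ using (ℤ)
import Data.Integer.Properties as ℤP
import Data.Integer.Tactic.RingSolver as ℤ-Solver
open import Data.Rational as ℚ using (ℚ; 0ℚ; 1ℚ; _+_; _*_; _-_; -_)
import Data.Rational.Properties as ℚP
open import Data.Rational.Unnormalised using (mkℚᵘ; *≡*)
import Data.Rational.Unnormalised.Properties as ℚᵘP
open import Data.Fin using (Fin; zero; suc)
open import Data.Fin.Properties using (all?; any?; ¬∀⟶∃¬)
open import Data.Fin.Subset using (Subset; inside; outside; ∣_∣; ⊤; ⊥; Nonempty; _∈_; _∉_; _⊆_; _∪_; _∩_; ⁅_⁆)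
open import Data.Fin.Subset.Properties
  using (_∈?_; _⊆?_; nonempty?; ⊆-refl; ⊆-antisym; ⊆⊤; ∈⊤; x∈⁅x⁆; x∈⁅y⁆⇒x≡y; ∪-idem; p⊆p∪q; q⊆p∪q;
         ∣p∣≤n; p⊆q⇒∣p∣≤∣q∣; ∣⁅x⁆∣≡1; ∣⊥∣≡0; ∣p∣≡n⇒p≡⊤; p⊂q⇒∣p∣<∣q∣)
open import Data.Vec using ([]; _∷_)
open import Data.Vec.Properties using (≡-dec)
open import Data.List using (List; []; _∷_; _++_; map; concatMap; filter; concat; tabulate; allFin)
import Data.List.Properties as ListP
open import Data.List.Relation.Unary.All using (All; []; _∷_; universal)
open import Data.List.Relation.Unary.All.Properties using (++⁺; map⁺; concat⁺)
open import Data.Product using (∃; _×_; _,_; proj₁)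
open import Data.Sum using (_⊎_; inj₁; inj₂)
open import Relation.Binary using (tri<; tri≈; tri>)
open import Relation.Binary.PropositionalEquality
open import Relation.Nullary using (Dec; yes; no; does; ¬_; ¬?; _×-dec_; _⊎-dec_; _→-dec_; contradiction)
open import Relation.Nullary.Decidable using (dec-false; dec-true; dec⇒maybe)
open import Tactic.RingSolver using (solve-∀)
open import Tactic.RingSolver.Core.AlmostCommutativeRing using (AlmostCommutativeRing; fromCommutativeRing)
open ≡-Reasoning

ℚ-ring : AlmostCommutativeRing 0ℓ 0ℓ
ℚ-ring = fromCommutativeRing ℚP.+-*-commutativeRing (λ x → dec⇒maybe (0ℚ ℚ.≟ x))

+-interchange : ∀ a b c d → (a + b) + (c + d) ≡ (a + c) + (b + d)
+-interchange = solve-∀ ℚ-ring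

𝟙 : Bool → ℚ
𝟙 true = 1ℚ
𝟙 false = 0ℚ

eqᵇ : ∀ {N} → Subset N → Subset N → Bool
eqᵇ X Y = does (≡-dec Bool._≟_ X Y)

-- Natural numbers in ℚ and finite sums

fromℕ : ℕ → ℚ
fromℕ zero = 0ℚ
fromℕ (suc x) = 1ℚ + fromℕ x

ℕtoℚ≡fromℕ : ∀ x → ℕtoℚ x ≡ fromℕ x
ℕtoℚ≡fromℕ zero = refl
ℕtoℚ≡fromℕ (suc x) = trans ℕtoℚ-suc (cong (1ℚ +_) (ℕtoℚ≡fromℕ x))
  where
  cross-multiplied : ∀ (X : ℤ) → (ℤ.+ 1 ℤ.+ X) ℤ.* ℤ.+ 1 ≡ (ℤ.+ 1 ℤ.* ℤ.+ 1 ℤ.+ X ℤ.* ℤ.+ 1) ℤ.* ℤ.+ 1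
  cross-multiplied = ℤ-Solver.solve-∀
  ℕtoℚ-suc : ℕtoℚ (suc x) ≡ 1ℚ + ℕtoℚ x
  ℕtoℚ-suc = ℚP.toℚᵘ-injective (ℚᵘP.≃-trans (ℚP.toℚᵘ-fromℚᵘ (mkℚᵘ (ℤ.+ suc x) 0))
    (ℚᵘP.≃-trans (*≡* (cross-multiplied (ℤ.+ x)))
    (ℚᵘP.≃-sym (ℚᵘP.≃-trans (ℚP.toℚᵘ-homo-+ 1ℚ (ℕtoℚ x))
      (ℚᵘP.+-cong (ℚP.toℚᵘ-fromℚᵘ (mkℚᵘ (ℤ.+ 1) 0)) (ℚP.toℚᵘ-fromℚᵘ (mkℚᵘ (ℤ.+ x) 0)))))))

fromℕ-+ : ∀ a b → fromℕ (a ℕ.+ b) ≡ fromℕ a + fromℕ b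
fromℕ-+ zero b = sym (ℚP.+-identityˡ _)
fromℕ-+ (suc a) b = trans (cong (1ℚ +_) (fromℕ-+ a b)) (sym (ℚP.+-assoc 1ℚ (fromℕ a) (fromℕ b)))

fromℕ-* : ∀ a b → fromℕ (a ℕ.* b) ≡ fromℕ a * fromℕ b
fromℕ-* zero b = sym (ℚP.*-zeroˡ (fromℕ b))
fromℕ-* (suc a) b = trans (fromℕ-+ b (a ℕ.* b)) (trans (cong (fromℕ b +_) (fromℕ-* a b)) (distrib (fromℕ a) (fromℕ b)))
  where
  distrib : ∀ x z → z + x * z ≡ (1ℚ + x) * z
  distrib = solve-∀ ℚ-ring

fromℕ-∸ : ∀ a b → b ≤ a → fromℕ (a ∸ b) ≡ fromℕ a - fromℕ b
fromℕ-∸ a b b≤a = sym (begin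
    fromℕ a - fromℕ b                  ≡⟨ cong (λ z → fromℕ z - fromℕ b) (sym (ℕP.m∸n+n≡m b≤a)) ⟩
    fromℕ (a ∸ b ℕ.+ b) - fromℕ b      ≡⟨ cong (_- fromℕ b) (fromℕ-+ (a ∸ b) b) ⟩
    fromℕ (a ∸ b) + fromℕ b - fromℕ b  ≡⟨ cancel (fromℕ (a ∸ b)) (fromℕ b) ⟩
    fromℕ (a ∸ b)                      ∎)
  where
  cancel : ∀ x y → x + y - y ≡ x
  cancel = solve-∀ ℚ-ring

frac*fromℕ : ∀ x c → 0 < c → frac x c * fromℕ c ≡ fromℕ x
frac*fromℕ x (suc d) _ =
  trans (cong (frac x (suc d) *_) (sym (ℕtoℚ≡fromℕ (suc d)))) (trans frac*ℕtoℚ (ℕtoℚ≡fromℕ x))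
  where
  frac*ℕtoℚ : frac x (suc d) * ℕtoℚ (suc d) ≡ ℕtoℚ x
  frac*ℕtoℚ = ℚP.toℚᵘ-injective (ℚᵘP.≃-trans (ℚP.toℚᵘ-homo-* (frac x (suc d)) (ℕtoℚ (suc d)))
    (ℚᵘP.≃-trans (ℚᵘP.*-cong (ℚP.toℚᵘ-fromℚᵘ (mkℚᵘ (ℤ.+ x) d)) (ℚP.toℚᵘ-fromℚᵘ (mkℚᵘ (ℤ.+ suc d) 0)))
    (ℚᵘP.≃-trans (*≡* (trans (ℤP.*-identityʳ _) (cong (λ z → ℤ.+ x ℤ.* ℤ.+ z) (sym (ℕP.*-identityʳ (suc d))))))
      (ℚᵘP.≃-sym (ℚP.toℚᵘ-fromℚᵘ (mkℚᵘ (ℤ.+ x) 0))))))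

fromℕ*frac1≡1 : ∀ c → 0 < c → fromℕ c * frac 1 c ≡ 1ℚ
fromℕ*frac1≡1 c 0<c = trans (ℚP.*-comm (fromℕ c) (frac 1 c)) (trans (frac*fromℕ 1 c 0<c) (ℚP.+-identityʳ 1ℚ))

*fromℕ-cancelʳ : ∀ {x y} c → 0 < c → x * fromℕ c ≡ y * fromℕ c → x ≡ y
*fromℕ-cancelʳ {x} {y} c 0<c x*c≡y*c = trans (sym (undo x)) (trans (cong (_* frac 1 c) x*c≡y*c) (undo y))
  where
  undo : ∀ z → (z * fromℕ c) * frac 1 c ≡ z
  undo z = trans (ℚP.*-assoc z (fromℕ c) (frac 1 c))
                 (trans (cong (z *_) (fromℕ*frac1≡1 c 0<c)) (ℚP.*-identityʳ z))

frac≡*frac1 : ∀ x c → 0 < c → frac x c ≡ fromℕ x * frac 1 c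
frac≡*frac1 x c 0<c = *fromℕ-cancelʳ c 0<c (begin
    frac x c * fromℕ c              ≡⟨ frac*fromℕ x c 0<c ⟩
    fromℕ x                         ≡⟨ sym (ℚP.*-identityʳ (fromℕ x)) ⟩
    fromℕ x * 1ℚ                    ≡⟨ cong (fromℕ x *_) (sym (fromℕ*frac1≡1 c 0<c)) ⟩
    fromℕ x * (fromℕ c * frac 1 c)  ≡⟨ regroup (fromℕ x) (fromℕ c) (frac 1 c) ⟩
    fromℕ x * frac 1 c * fromℕ c    ∎)
  where
  regroup : ∀ x c i → x * (c * i) ≡ x * i * c
  regroup = solve-∀ ℚ-ring

∑ : ∀ {A : Set} → (A → ℚ) → List A → ℚ
∑ f [] = 0ℚ
∑ f (x ∷ xs) = f x + ∑ f xs

∑-++ : ∀ {A : Set} (f : A → ℚ) xs ys → ∑ f (xs ++ ys) ≡ ∑ f xs + ∑ f ys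
∑-++ f [] ys = sym (ℚP.+-identityˡ _)
∑-++ f (x ∷ xs) ys rewrite ∑-++ f xs ys = sym (ℚP.+-assoc (f x) _ _)

∑-map : ∀ {A B : Set} (f : B → ℚ) (g : A → B) xs → ∑ f (map g xs) ≡ ∑ (λ x → f (g x)) xs
∑-map f g [] = refl
∑-map f g (x ∷ xs) = cong (f (g x) +_) (∑-map f g xs)

∑-cong : ∀ {A : Set} {f g : A → ℚ} xs → (∀ x → f x ≡ g x) → ∑ f xs ≡ ∑ g xs
∑-cong [] e = refl
∑-cong (x ∷ xs) e = cong₂ _+_ (e x) (∑-cong xs e)

∑-zero : ∀ {A : Set} (xs : List A) → ∑ (λ _ → 0ℚ) xs ≡ 0ℚ
∑-zero [] = refl
∑-zero (x ∷ xs) rewrite ∑-zero xs = refl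

∑-+ : ∀ {A : Set} (f g : A → ℚ) xs → ∑ (λ x → f x + g x) xs ≡ ∑ f xs + ∑ g xs
∑-+ f g [] = refl
∑-+ f g (x ∷ xs) rewrite ∑-+ f g xs = +-interchange (f x) (g x) (∑ f xs) (∑ g xs)

∑-*ˡ : ∀ {A : Set} (a : ℚ) (f : A → ℚ) xs → ∑ (λ x → a * f x) xs ≡ a * ∑ f xs
∑-*ˡ a f [] = sym (ℚP.*-zeroʳ a)
∑-*ˡ a f (x ∷ xs) rewrite ∑-*ˡ a f xs = sym (ℚP.*-distribˡ-+ a (f x) _)

∑-*ʳ : ∀ {A : Set} (a : ℚ) (f : A → ℚ) xs → ∑ (λ x → f x * a) xs ≡ ∑ f xs * a
∑-*ʳ a f xs = trans (∑-cong xs (λ x → ℚP.*-comm (f x) a)) (trans (∑-*ˡ a f xs) (ℚP.*-comm a _))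

∑-concat : ∀ {A : Set} (f : A → ℚ) xss → ∑ f (concat xss) ≡ ∑ (∑ f) xss
∑-concat f [] = refl
∑-concat f (xs ∷ xss) = trans (∑-++ f xs (concat xss)) (cong (∑ f xs +_) (∑-concat f xss))

∑-concatMap : ∀ {A B : Set} (f : B → ℚ) (g : A → List B) xs →
  ∑ f (concatMap g xs) ≡ ∑ (λ x → ∑ f (g x)) xs
∑-concatMap f g xs = trans (∑-concat f (map g xs)) (∑-map (∑ f) g xs)

∑-filter : ∀ {A : Set} {P : A → Set} (P? : ∀ x → Dec (P x)) (f : A → ℚ) xs →
  ∑ f (filter P? xs) ≡ ∑ (λ x → 𝟙 (does (P? x)) * f x) xs
∑-filter P? f [] = refl
∑-filter P? f (x ∷ xs) with does (P? x)
... | true = cong₂ _+_ (sym (ℚP.*-identityˡ (f x))) (∑-filter P? f xs)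
... | false = trans (∑-filter P? f xs) (sym (trans (cong (_+ _) (ℚP.*-zeroˡ (f x))) (ℚP.+-identityˡ _)))

∑-*-∑ : ∀ {A B : Set} (f : A → ℚ) (g : B → ℚ) xs ys →
  ∑ (λ x → ∑ (λ y → f x * g y) ys) xs ≡ ∑ f xs * ∑ g ys
∑-*-∑ f g xs ys = trans (∑-cong xs (λ x → ∑-*ˡ (f x) g ys)) (∑-*ʳ (∑ g ys) f xs)

∑∑-*ˡ : ∀ {A B : Set} (x : ℚ) (g : A → B → ℚ) Es Fs →
  ∑ (λ e → ∑ (λ f → x * g e f) Fs) Es ≡ x * ∑ (λ e → ∑ (g e) Fs) Es
∑∑-*ˡ x g Es Fs = trans (∑-cong Es (λ e → ∑-*ˡ x (g e) Fs)) (∑-*ˡ x _ Es)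

∑Fin : ∀ N → (Fin N → ℚ) → ℚ
∑Fin zero F = 0ℚ
∑Fin (suc N) F = F zero + ∑Fin N (λ i → F (suc i))

∑-tabulate : ∀ {A : Set} N (g : Fin N → A) (h : A → ℚ) → ∑ h (tabulate g) ≡ ∑Fin N (λ i → h (g i))
∑-tabulate zero g h = refl
∑-tabulate (suc N) g h = cong (h (g zero) +_) (∑-tabulate N (λ i → g (suc i)) h)

∑Fin-𝟙∈ : ∀ N (Z : Subset N) → ∑Fin N (λ e → 𝟙 (does (e ∈? Z))) ≡ fromℕ ∣ Z ∣
∑Fin-𝟙∈ zero [] = refl
∑Fin-𝟙∈ (suc N) (inside ∷ Z) = cong (1ℚ +_) (∑Fin-𝟙∈ N Z)
∑Fin-𝟙∈ (suc N) (outside ∷ Z) = trans (ℚP.+-identityˡ _) (∑Fin-𝟙∈ N Z)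

∑Fin-cong : ∀ N {F G : Fin N → ℚ} → (∀ i → F i ≡ G i) → ∑Fin N F ≡ ∑Fin N G
∑Fin-cong zero e = refl
∑Fin-cong (suc N) e = cong₂ _+_ (e zero) (∑Fin-cong N (λ i → e (suc i)))

∑Fin-+ : ∀ N (F G : Fin N → ℚ) → ∑Fin N (λ i → F i + G i) ≡ ∑Fin N F + ∑Fin N G
∑Fin-+ zero F G = refl
∑Fin-+ (suc N) F G rewrite ∑Fin-+ N (λ i → F (suc i)) (λ i → G (suc i)) = +-interchange (F zero) (G zero) _ _

∑Fin-*ˡ : ∀ N a (F : Fin N → ℚ) → ∑Fin N (λ i → a * F i) ≡ a * ∑Fin N F
∑Fin-*ˡ zero a F = sym (ℚP.*-zeroʳ a)
∑Fin-*ˡ (suc N) a F rewrite ∑Fin-*ˡ N a (λ i → F (suc i)) = sym (ℚP.*-distribˡ-+ a (F zero) _)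

∑Fin-1 : ∀ N → ∑Fin N (λ _ → 1ℚ) ≡ fromℕ N
∑Fin-1 zero = refl
∑Fin-1 (suc N) = cong (1ℚ +_) (∑Fin-1 N)

∑Fin-− : ∀ N (F G : Fin N → ℚ) → ∑Fin N (λ i → F i - G i) ≡ ∑Fin N F - ∑Fin N G
∑Fin-− N F G = trans (∑Fin-cong N (λ i → sym (minus (F i) (G i))))
  (trans (∑Fin-+ N F (λ i → (- 1ℚ) * G i)) (trans (cong (∑Fin N F +_) (∑Fin-*ˡ N (- 1ℚ) G)) (minus (∑Fin N F) (∑Fin N G))))
  where
  minus : ∀ x y → x + (- 1ℚ) * y ≡ x - y
  minus = solve-∀ ℚ-ring

-- Coefficients of polynomials

coeffOfTerm : ∀ {N} → Monomial N → ℚ × Monomial N → ℚ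
coeffOfTerm m (c , m') = c * 𝟙 (sameMon m m')

if-0≡*𝟙 : ∀ (b : Bool) c → (if b then c else 0ℚ) ≡ c * 𝟙 b
if-0≡*𝟙 true c = sym (ℚP.*-identityʳ c)
if-0≡*𝟙 false c = sym (ℚP.*-zeroʳ c)

coeff≡∑ : ∀ {N} (p : Poly N) m → coeff p m ≡ ∑ (coeffOfTerm m) p
coeff≡∑ [] m = refl
coeff≡∑ ((c , m') ∷ p) m = cong₂ _+_ (if-0≡*𝟙 (sameMon m m') c) (coeff≡∑ p m)

coeff-++ : ∀ {N} (p q : Poly N) m → coeff (p ++ q) m ≡ coeff p m + coeff q m
coeff-++ p q m = trans (coeff≡∑ (p ++ q) m) (trans (∑-++ (coeffOfTerm m) p q)
  (sym (cong₂ _+_ (coeff≡∑ p m) (coeff≡∑ q m))))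

coeff-scale : ∀ {N} a (p : Poly N) m → coeff (scale a p) m ≡ a * coeff p m
coeff-scale a p m = trans (coeff≡∑ (scale a p) m) (trans (∑-map (coeffOfTerm m) _ p)
  (trans (∑-cong p (λ { (c , m') → ℚP.*-assoc a c _ })) (trans (∑-*ˡ a (coeffOfTerm m) p)
  (cong (a *_) (sym (coeff≡∑ p m))))))

coeff-concatMap : ∀ {N} {A : Set} (g : A → Poly N) xs m → coeff (concatMap g xs) m ≡ ∑ (λ x → coeff (g x) m) xs
coeff-concatMap g xs m = trans (coeff≡∑ (concatMap g xs) m) (trans (∑-concatMap (coeffOfTerm m) g xs)
  (∑-cong xs (λ x → sym (coeff≡∑ (g x) m))))

count-∷ : ∀ {N} (X Y : Subset N) m → count X (Y ∷ m) ≡ (if eqᵇ X Y then suc (count X m) else count X m)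
count-∷ X Y m with does (≡-dec Bool._≟_ X Y)
... | true = refl
... | false = refl

eqᵇ-refl : ∀ {N} (X : Subset N) → eqᵇ X X ≡ true
eqᵇ-refl X with ≡-dec Bool._≟_ X X
... | yes _ = refl
... | no ¬p = ⊥-elim (¬p refl)

eqᵇ⇒≡ : ∀ {N} {X Y : Subset N} → eqᵇ X Y ≡ true → X ≡ Y
eqᵇ⇒≡ {X = X} {Y} e with ≡-dec Bool._≟_ X Y
... | yes p = p
eqᵇ⇒≡ {X = X} {Y} () | no _

record _≈ₘ_ {N} (m m' : Monomial N) : Set where
  constructor mk≈ₘ
  field count≡ : ∀ X → count X m ≡ count X m'
open _≈ₘ_ public

count-++ : ∀ {N} (X : Subset N) m m' → count X (m ++ m') ≡ count X m ℕ.+ count X m'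
count-++ X [] m' = refl
count-++ X (Y ∷ m) m' rewrite count-∷ X Y (m ++ m') | count-∷ X Y m | count-++ X m m' with eqᵇ X Y
... | true = refl
... | false = refl

∧-trueˡ : ∀ {a b} → a ∧ b ≡ true → a ≡ true
∧-trueˡ {true} e = refl
∧-trueʳ : ∀ {a b} → a ∧ b ≡ true → b ≡ true
∧-trueʳ {true} e = e
∧-trueʳ {false} ()

allᵇ-count≢0 : ∀ {N} (P : Subset N → Bool) X l → count X l ≢ 0 → allᵇ P l ≡ true → P X ≡ true
allᵇ-count≢0 P X [] nz a = ⊥-elim (nz refl)
allᵇ-count≢0 P X (Y ∷ l) nz a with eqᵇ X Y in e
... | true = subst (λ z → P z ≡ true) (sym (eqᵇ⇒≡ e)) (∧-trueˡ a)
... | false = allᵇ-count≢0 P X l nz (∧-trueʳ {P Y} a)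

≡ᵇ-refl : ∀ n → (n ≡ᵇ n) ≡ true
≡ᵇ-refl zero = refl
≡ᵇ-refl (suc n) = ≡ᵇ-refl n

≡ᵇ-true⇒≡ : ∀ {m n} → (m ≡ᵇ n) ≡ true → m ≡ n
≡ᵇ-true⇒≡ {m} {n} e = ℕP.≡ᵇ⇒≡ m n (subst T (sym e) tt)

sameMon⇒count≡ : ∀ {N} (m m' : Monomial N) → sameMon m m' ≡ true → ∀ X → count X m ≡ count X m'
sameMon⇒count≡ m m' s X with count X (m ++ m') in e
... | zero = trans (ℕP.m+n≡0⇒m≡0 _ (trans (sym (count-++ X m m')) e))
                   (sym (ℕP.m+n≡0⇒n≡0 (count X m) (trans (sym (count-++ X m m')) e)))
... | suc k = ≡ᵇ-true⇒≡ (allᵇ-count≢0 (λ S → count S m ≡ᵇ count S m') X (m ++ m') (λ z → ℕP.1+n≢0 (trans (sym e) z)) s)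

sameMon-sound : ∀ {N} (m m' : Monomial N) → sameMon m m' ≡ true → m ≈ₘ m'
sameMon-sound m m' s = mk≈ₘ (sameMon⇒count≡ m m' s)

allᵇ-intro : ∀ {A : Set} (P : A → Bool) l → (∀ x → P x ≡ true) → allᵇ P l ≡ true
allᵇ-intro P [] h = refl
allᵇ-intro P (x ∷ l) h rewrite h x = allᵇ-intro P l h

sameMon-complete : ∀ {N} {m m' : Monomial N} → m ≈ₘ m' → sameMon m m' ≡ true
sameMon-complete {m = m} {m'} (mk≈ₘ h) = allᵇ-intro _ (m ++ m') (λ X → subst (λ z → (count X m ≡ᵇ z) ≡ true) (h X) (≡ᵇ-refl (count X m)))

≈ₘ-trans : ∀ {N} {a b c : Monomial N} → a ≈ₘ b → b ≈ₘ c → a ≈ₘ c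
≈ₘ-trans (mk≈ₘ p) (mk≈ₘ q) = mk≈ₘ (λ X → trans (p X) (q X))
≈ₘ-sym : ∀ {N} {a b : Monomial N} → a ≈ₘ b → b ≈ₘ a
≈ₘ-sym (mk≈ₘ p) = mk≈ₘ (λ X → sym (p X))

bool-ext : ∀ {a b : Bool} → (a ≡ true → b ≡ true) → (b ≡ true → a ≡ true) → a ≡ b
bool-ext {true} {true} f g = refl
bool-ext {false} {false} f g = refl
bool-ext {true} {false} f g with f refl
... | ()
bool-ext {false} {true} f g with g refl
... | ()

sameMon-respʳ : ∀ {N} (m : Monomial N) {m' m''} → m' ≈ₘ m'' → sameMon m m' ≡ sameMon m m''
sameMon-respʳ m {m'} {m''} h = bool-ext (λ s → sameMon-complete (≈ₘ-trans (sameMon-sound m m' s) h))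
                              (λ s → sameMon-complete (≈ₘ-trans (sameMon-sound m m'' s) (≈ₘ-sym h)))

sameMon-respˡ : ∀ {N} {m m0 : Monomial N} (m' : Monomial N) → m ≈ₘ m0 → sameMon m m' ≡ sameMon m0 m'
sameMon-respˡ {m = m} {m0} m' h = bool-ext (λ s → sameMon-complete (≈ₘ-trans (≈ₘ-sym h) (sameMon-sound m m' s)))
                              (λ s → sameMon-complete (≈ₘ-trans h (sameMon-sound m0 m' s)))

count-swap : ∀ {N} (S T : Subset N) X → count X (S ∷ T ∷ []) ≡ count X (T ∷ S ∷ [])
count-swap S T X rewrite count-∷ X S (T ∷ []) | count-∷ X T (S ∷ []) | count-∷ X S [] | count-∷ X T [] with eqᵇ X S | eqᵇ X T
... | true | true = refl
... | true | false = refl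
... | false | true = refl
... | false | false = refl

swap≈ₘ : ∀ {N} (S T : Subset N) → (S ∷ T ∷ []) ≈ₘ (T ∷ S ∷ [])
swap≈ₘ S T = mk≈ₘ (count-swap S T)

count-∷-cancel : ∀ {N} (Y : Subset N) l l' → (∀ X → count X (Y ∷ l) ≡ count X (Y ∷ l')) → ∀ X → count X l ≡ count X l'
count-∷-cancel Y l l' h X with h X
... | e rewrite count-∷ X Y l | count-∷ X Y l' with eqᵇ X Y
... | true = ℕP.suc-injective e
... | false = e

∷-cancel≈ₘ : ∀ {N} (Y : Subset N) l l' → (Y ∷ l) ≈ₘ (Y ∷ l') → l ≈ₘ l'
∷-cancel≈ₘ Y l l' (mk≈ₘ h) = mk≈ₘ (count-∷-cancel Y l l' h)

count-self : ∀ {N} (X : Subset N) l → count X (X ∷ l) ≡ suc (count X l)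
count-self X l rewrite count-∷ X X l | eqᵇ-refl X = refl

singleton-≈ₘ⇒≡ : ∀ {N} {B T : Subset N} → (B ∷ []) ≈ₘ (T ∷ []) → B ≡ T
singleton-≈ₘ⇒≡ {B = B} {T} (mk≈ₘ h) with h B
... | e rewrite count-self B [] | count-∷ B T [] with eqᵇ B T in q
... | true = eqᵇ⇒≡ q
... | false = ⊥-elim (ℕP.1+n≢0 e)

count-pair≢0 : ∀ {N} (S A B : Subset N) → count S (A ∷ B ∷ []) ≢ 0 → (S ≡ A) ⊎ (S ≡ B)
count-pair≢0 S A B nz with eqᵇ S A in e1
... | true = inj₁ (eqᵇ⇒≡ e1)
... | false with eqᵇ S B in e2
...   | true = inj₂ (eqᵇ⇒≡ e2)
...   | false = ⊥-elim (nz refl)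

∨-elim : ∀ a {b} → a ∨ b ≡ true → (a ≡ true) ⊎ (b ≡ true)
∨-elim true e = inj₁ refl
∨-elim false e = inj₂ e

≈ₘ-pair⇒ : ∀ {N} (A B S T : Subset N) → (A ∷ B ∷ []) ≈ₘ (S ∷ T ∷ []) → ((eqᵇ A S ∧ eqᵇ B T) ∨ (eqᵇ A T ∧ eqᵇ B S)) ≡ true
≈ₘ-pair⇒ A B S T h with eqᵇ A S in e1
... | true with eqᵇ⇒≡ {X = A} {Y = S} e1
...   | refl with singleton-≈ₘ⇒≡ (∷-cancel≈ₘ A (B ∷ []) (T ∷ []) h)
...     | refl rewrite eqᵇ-refl B = refl
≈ₘ-pair⇒ A B S T h | false with count-pair≢0 S A B (λ z → ℕP.1+n≢0 (trans (sym (count-self S (T ∷ []))) (trans (sym (count≡ h S)) z)))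
... | inj₁ refl = contradiction (trans (sym e1) (eqᵇ-refl A)) λ ()
... | inj₂ refl with singleton-≈ₘ⇒≡ (∷-cancel≈ₘ S (A ∷ []) (T ∷ []) (≈ₘ-trans (swap≈ₘ S A) h))
...   | refl rewrite eqᵇ-refl A | eqᵇ-refl S = refl

sameMon-pair-⇒ : ∀ {N} (A B S T : Subset N) → sameMon (A ∷ B ∷ []) (S ∷ T ∷ []) ≡ true → ((eqᵇ A S ∧ eqᵇ B T) ∨ (eqᵇ A T ∧ eqᵇ B S)) ≡ true
sameMon-pair-⇒ A B S T s = ≈ₘ-pair⇒ A B S T (sameMon-sound _ _ s)

sameMon-pair-⇐ : ∀ {N} (A B S T : Subset N) → ((eqᵇ A S ∧ eqᵇ B T) ∨ (eqᵇ A T ∧ eqᵇ B S)) ≡ true → sameMon (A ∷ B ∷ []) (S ∷ T ∷ []) ≡ true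
sameMon-pair-⇐ A B S T d with ∨-elim (eqᵇ A S ∧ eqᵇ B T) d
... | inj₁ p = subst₂ (λ s t → sameMon (A ∷ B ∷ []) (s ∷ t ∷ []) ≡ true)
                 (eqᵇ⇒≡ {X = A} {Y = S} (∧-trueˡ p)) (eqᵇ⇒≡ {X = B} {Y = T} (∧-trueʳ {eqᵇ A S} p))
                 (sameMon-complete {m = A ∷ B ∷ []} {m' = A ∷ B ∷ []} (mk≈ₘ λ _ → refl))
... | inj₂ p = subst₂ (λ s t → sameMon (A ∷ B ∷ []) (s ∷ t ∷ []) ≡ true)
                 (eqᵇ⇒≡ {X = B} {Y = S} (∧-trueʳ {eqᵇ A T} p)) (eqᵇ⇒≡ {X = A} {Y = T} (∧-trueˡ p))
                 (sameMon-complete {m = A ∷ B ∷ []} {m' = B ∷ A ∷ []} (swap≈ₘ A B))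

sameMon-pair : ∀ {N} (A B S T : Subset N) →
  sameMon (A ∷ B ∷ []) (S ∷ T ∷ []) ≡ ((eqᵇ A S ∧ eqᵇ B T) ∨ (eqᵇ A T ∧ eqᵇ B S))
sameMon-pair A B S T = bool-ext (sameMon-pair-⇒ A B S T) (sameMon-pair-⇐ A B S T)

coeff-−ₚ : ∀ {N} (x y : Poly N) mm → coeff (x -ₚ y) mm ≡ coeff x mm + (- 1ℚ) * coeff y mm
coeff-−ₚ x y mm = trans (coeff-++ x _ mm) (cong (coeff x mm +_) (coeff-scale (- 1ℚ) y mm))

coeff-swap : ∀ {N} (X : Poly N) S T → coeff X (S ∷ T ∷ []) ≡ coeff X (T ∷ S ∷ [])
coeff-swap X S T = trans (coeff≡∑ X _) (trans (∑-cong X (λ { (c , m) → cong (λ b → c * 𝟙 b) (sameMon-respˡ m (swap≈ₘ S T)) }))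
  (sym (coeff≡∑ X _)))

if-cong : ∀ (b : Bool) {x x' y y' : ℚ} → x ≡ x' → y ≡ y' → (if b then x else y) ≡ (if b then x' else y')
if-cong true  x≡x' _ = x≡x'
if-cong false _ y≡y' = y≡y'

x≡y⇒x-y≡0 : ∀ {x y} → x ≡ y → x + (- 1ℚ) * y ≡ 0ℚ
x≡y⇒x-y≡0 {x} refl = x-x≡0 x
  where
  x-x≡0 : ∀ x → x + (- 1ℚ) * x ≡ 0ℚ
  x-x≡0 = solve-∀ ℚ-ring

coeff-*ₚ : ∀ {N} (p q : Poly N) m →
  coeff (p *ₚ q) m ≡ ∑ (λ { (a , m₁) → ∑ (λ { (b , m₂) → (a * b) * 𝟙 (sameMon m (m₁ ++ m₂)) }) q }) p
coeff-*ₚ [] q m = refl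
coeff-*ₚ ((a , m₁) ∷ p) q m = trans (coeff-++ (map _ q) (p *ₚ q) m)
  (cong₂ _+_ (trans (coeff≡∑ (map _ q) m) (∑-map (coeffOfTerm m) _ q)) (coeff-*ₚ p q m))

LinForm : ℕ → Set
LinForm N = List (ℚ × Subset N)

termₗ : ∀ {N} → ℚ × Subset N → ℚ × Monomial N
termₗ (c , S) = (c , S ∷ [])

toPoly : ∀ {N} → LinForm N → Poly N
toPoly = map termₗ

coeffOfTermₗ : ∀ {N} → Subset N → ℚ × Subset N → ℚ
coeffOfTermₗ X (c , S) = c * 𝟙 (eqᵇ X S)

coeffₗ : ∀ {N} → LinForm N → Subset N → ℚ
coeffₗ ps X = ∑ (coeffOfTermₗ X) ps

𝟙-∧-∨-∧-swap : ∀ x y → 𝟙 ((x ∧ y) ∨ (y ∧ x)) ≡ 𝟙 x * 𝟙 y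
𝟙-∧-∨-∧-swap true true = refl
𝟙-∧-∨-∧-swap true false = refl
𝟙-∧-∨-∧-swap false true = refl
𝟙-∧-∨-∧-swap false false = refl

𝟙-∨-disjoint : ∀ x y z w → (x ∧ w) ≡ false → 𝟙 ((x ∧ y) ∨ (z ∧ w)) ≡ 𝟙 x * 𝟙 y + 𝟙 z * 𝟙 w
𝟙-∨-disjoint true true true true ()
𝟙-∨-disjoint true true true false e = refl
𝟙-∨-disjoint true true false true ()
𝟙-∨-disjoint true true false false e = refl
𝟙-∨-disjoint true false true true ()
𝟙-∨-disjoint true false true false e = refl
𝟙-∨-disjoint true false false true ()
𝟙-∨-disjoint true false false false e = refl
𝟙-∨-disjoint false true true true e = refl
𝟙-∨-disjoint false true true false e = refl
𝟙-∨-disjoint false true false true e = refl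
𝟙-∨-disjoint false true false false e = refl
𝟙-∨-disjoint false false true true e = refl
𝟙-∨-disjoint false false true false e = refl
𝟙-∨-disjoint false false false true e = refl
𝟙-∨-disjoint false false false false e = refl

eqᵇ-∧-eqᵇ-distinct : ∀ {N} (A B S : Subset N) → eqᵇ A B ≡ false → (eqᵇ A S ∧ eqᵇ B S) ≡ false
eqᵇ-∧-eqᵇ-distinct A B S ne with eqᵇ A S in e1 | eqᵇ B S in e2
... | true | true = contradiction (trans (sym ne) (subst (λ z → eqᵇ A z ≡ true) (trans (eqᵇ⇒≡ {X = A} {Y = S} e1) (sym (eqᵇ⇒≡ {X = B} {Y = S} e2))) (eqᵇ-refl A))) λ ()
... | true | false = refl
... | false | _ = refl

coeff-toPoly-*ₚ : ∀ {N} (ps qs : LinForm N) A B →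
  coeff (toPoly ps *ₚ toPoly qs) (A ∷ B ∷ []) ≡
  (if eqᵇ A B then coeffₗ ps A * coeffₗ qs A else coeffₗ ps A * coeffₗ qs B + coeffₗ ps B * coeffₗ qs A)
coeff-toPoly-*ₚ ps qs A B with eqᵇ A B in eAB
... | true with eqᵇ⇒≡ {X = A} {Y = B} eAB
...   | refl = trans (coeff-*ₚ (toPoly ps) (toPoly qs) (A ∷ A ∷ []))
  (trans (∑-map _ termₗ ps) (trans (∑-cong ps (λ { (a , S) → trans (∑-map _ termₗ qs)
     (∑-cong qs (λ { (b , T) → trans (cong (λ z → (a * b) * 𝟙 z) (sameMon-pair A A S T))
        (trans (cong ((a * b) *_) (𝟙-∧-∨-∧-swap (eqᵇ A S) (eqᵇ A T))) (rearr1 a b _ _)) })) }))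
   (∑-*-∑ (coeffOfTermₗ A) (coeffOfTermₗ A) ps qs)))
  where
  rearr1 : ∀ a b x y → (a * b) * (x * y) ≡ (a * x) * (b * y)
  rearr1 = solve-∀ ℚ-ring
coeff-toPoly-*ₚ ps qs A B | false = trans (coeff-*ₚ (toPoly ps) (toPoly qs) (A ∷ B ∷ []))
  (trans (∑-map _ termₗ ps) (trans (∑-cong ps (λ { (a , S) → trans (∑-map _ termₗ qs)
     (trans (∑-cong qs (λ { (b , T) → trans (cong (λ z → (a * b) * 𝟙 z) (sameMon-pair A B S T))
        (trans (cong ((a * b) *_) (𝟙-∨-disjoint (eqᵇ A S) (eqᵇ B T) (eqᵇ A T) (eqᵇ B S) (eqᵇ-∧-eqᵇ-distinct A B S eAB)))
          (rearr2 a b _ _ _ _)) }))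
      (∑-+ (λ y → coeffOfTermₗ A (a , S) * coeffOfTermₗ B y) (λ y → coeffOfTermₗ B (a , S) * coeffOfTermₗ A y) qs)) }))
   (trans (∑-+ (λ x → ∑ (λ y → coeffOfTermₗ A x * coeffOfTermₗ B y) qs) (λ x → ∑ (λ y → coeffOfTermₗ B x * coeffOfTermₗ A y) qs) ps)
     (cong₂ _+_ (∑-*-∑ (coeffOfTermₗ A) (coeffOfTermₗ B) ps qs) (∑-*-∑ (coeffOfTermₗ B) (coeffOfTermₗ A) ps qs)))))
  where
  rearr2 : ∀ a b x y z w → (a * b) * (x * y + z * w) ≡ (a * x) * (b * y) + (a * w) * (b * z)
  rearr2 = solve-∀ ℚ-ring

coeffₗ-singleton : ∀ {N} c (T X : Subset N) → coeffₗ ((c , T) ∷ []) X ≡ c * 𝟙 (eqᵇ X T) + 0ℚ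
coeffₗ-singleton c T X = refl

bilinear : ∀ {N} {A : Set} → (A → LinForm N) → (A → LinForm N) → List A → Subset N → Subset N → ℚ
bilinear ℓ ℓ' xs X Y = ∑ (λ x → coeffₗ (ℓ x) X * coeffₗ (ℓ' x) Y) xs

if-+ : ∀ b (a a' c c' d d' : ℚ) →
  (if b then a else c + d) + (if b then a' else c' + d') ≡ (if b then a + a' else (c + c') + (d + d'))
if-+ true  a a' c c' d d' = refl
if-+ false a a' c c' d d' = +-interchange c d c' d'

coeff-concatMap-toPoly-*ₚ : ∀ {N} {A : Set} (ℓ ℓ' : A → LinForm N) xs X Y →
  coeff (concatMap (λ x → toPoly (ℓ x) *ₚ toPoly (ℓ' x)) xs) (X ∷ Y ∷ []) ≡
  (if eqᵇ X Y then bilinear ℓ ℓ' xs X X else bilinear ℓ ℓ' xs X Y + bilinear ℓ ℓ' xs Y X)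
coeff-concatMap-toPoly-*ₚ ℓ ℓ' [] X Y with eqᵇ X Y
... | true  = refl
... | false = sym (ℚP.+-identityʳ 0ℚ)
coeff-concatMap-toPoly-*ₚ {N} ℓ ℓ' (x ∷ xs) X Y =
  trans (coeff-++ (toPoly (ℓ x) *ₚ toPoly (ℓ' x)) _ (X ∷ Y ∷ []))
  (trans (cong₂ _+_ (coeff-toPoly-*ₚ (ℓ x) (ℓ' x) X Y) (coeff-concatMap-toPoly-*ₚ ℓ ℓ' xs X Y))
         (if-+ (eqᵇ X Y) (c X X) (bilinear ℓ ℓ' xs X X) (c X Y) (bilinear ℓ ℓ' xs X Y) (c Y X) (bilinear ℓ ℓ' xs Y X)))
  where
  c : Subset N → Subset N → ℚ
  c U W = coeffₗ (ℓ x) U * coeffₗ (ℓ' x) W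

∑-allSubsets-select : ∀ N (h : Subset N → ℚ) X → ∑ (λ S → h S * 𝟙 (eqᵇ X S)) (allSubsets N) ≡ h X
∑-allSubsets-select zero h [] = trans (ℚP.+-identityʳ _) (ℚP.*-identityʳ _)
∑-allSubsets-select (suc N) h (true ∷ X) = trans (∑-++ _ (map (true ∷_) (allSubsets N)) (map (false ∷_) (allSubsets N)))
  (trans (cong₂ _+_ (trans (∑-map _ (true ∷_) (allSubsets N)) (∑-allSubsets-select N (λ S → h (true ∷ S)) X))
                    (trans (∑-map _ (false ∷_) (allSubsets N)) (trans (∑-cong (allSubsets N) (λ S → ℚP.*-zeroʳ (h (false ∷ S)))) (∑-zero (allSubsets N)))))
   (ℚP.+-identityʳ _))
∑-allSubsets-select (suc N) h (false ∷ X) = trans (∑-++ _ (map (true ∷_) (allSubsets N)) (map (false ∷_) (allSubsets N)))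
  (trans (cong₂ _+_ (trans (∑-map _ (true ∷_) (allSubsets N)) (trans (∑-cong (allSubsets N) (λ S → ℚP.*-zeroʳ (h (true ∷ S)))) (∑-zero (allSubsets N))))
                    (trans (∑-map _ (false ∷_) (allSubsets N)) (∑-allSubsets-select N (λ S → h (false ∷ S)) X)))
   (ℚP.+-identityˡ _))

∑-filter-allSubsets-select : ∀ N {P : Subset N → Set} (P? : ∀ S → Dec (P S)) (h : Subset N → ℚ) X →
  ∑ (λ S → h S * 𝟙 (eqᵇ X S)) (filter P? (allSubsets N)) ≡ 𝟙 (does (P? X)) * h X
∑-filter-allSubsets-select N P? h X = trans (∑-filter P? _ (allSubsets N))
  (trans (∑-cong (allSubsets N) (λ S → sym (ℚP.*-assoc (𝟙 (does (P? S))) (h S) _)))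
  (∑-allSubsets-select N (λ S → 𝟙 (does (P? S)) * h S) X))

scaleTermₗ : ∀ {N} → ℚ → ℚ × Subset N → ℚ × Subset N
scaleTermₗ a (c , S) = (a * c , S)

unitTermₗ : ∀ {N} → Subset N → ℚ × Subset N
unitTermₗ S = (1ℚ , S)

sumₚ-var≡toPoly : ∀ {N} (L : List (Subset N)) → sumₚ (map var L) ≡ toPoly (map unitTermₗ L)
sumₚ-var≡toPoly [] = refl
sumₚ-var≡toPoly (S ∷ L) = cong ((1ℚ , S ∷ []) ∷_) (sumₚ-var≡toPoly L)

sumₚ-scale-var≡toPoly : ∀ {N} (g : Subset N → ℚ) (L : List (Subset N)) →
  sumₚ (map (λ S → scale (g S) (var S)) L) ≡ toPoly (map (λ S → (g S * 1ℚ , S)) L)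
sumₚ-scale-var≡toPoly g [] = refl
sumₚ-scale-var≡toPoly g (S ∷ L) = cong ((g S * 1ℚ , S ∷ []) ∷_) (sumₚ-scale-var≡toPoly g L)

toPoly-++ : ∀ {N} (ps qs : LinForm N) → toPoly (ps ++ qs) ≡ toPoly ps ++ toPoly qs
toPoly-++ ps qs = ListP.map-++ termₗ ps qs

scale-toPoly : ∀ {N} a (ps : LinForm N) → scale a (toPoly ps) ≡ toPoly (map (scaleTermₗ a) ps)
scale-toPoly a [] = refl
scale-toPoly a ((c , S) ∷ ps) = cong ((a * c , S ∷ []) ∷_) (scale-toPoly a ps)

coeffₗ-++ : ∀ {N} (ps qs : LinForm N) X → coeffₗ (ps ++ qs) X ≡ coeffₗ ps X + coeffₗ qs X
coeffₗ-++ ps qs X = ∑-++ (coeffOfTermₗ X) ps qs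

coeffₗ-scale : ∀ {N} a (ps : LinForm N) X → coeffₗ (map (scaleTermₗ a) ps) X ≡ a * coeffₗ ps X
coeffₗ-scale a ps X = trans (∑-map (coeffOfTermₗ X) (scaleTermₗ a) ps)
  (trans (∑-cong ps (λ { (c , S) → ℚP.*-assoc a c _ })) (∑-*ˡ a (coeffOfTermₗ X) ps))

containingₗ : ∀ {N} → Fin N → LinForm N
containingₗ {N} i = map unitTermₗ (filter (λ S → i ∈? S) (allSubsets N))

containing≡toPoly : ∀ {N} (i : Fin N) → containing i ≡ toPoly (containingₗ i)
containing≡toPoly {N} i = sumₚ-var≡toPoly (filter (λ S → i ∈? S) (allSubsets N))

coeffₗ-containing : ∀ {N} (i : Fin N) X → coeffₗ (containingₗ i) X ≡ 𝟙 (does (i ∈? X)) * 1ℚ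
coeffₗ-containing {N} i X = trans (∑-map (coeffOfTermₗ X) unitTermₗ (filter (λ S → i ∈? S) (allSubsets N))) (∑-filter-allSubsets-select N (λ S → i ∈? S) (λ _ → 1ℚ) X)

linearGenₗ : ∀ {N} → Fin N → Fin N → LinForm N
linearGenₗ e f = containingₗ e ++ map (scaleTermₗ (- 1ℚ)) (containingₗ f)

genPoly-linear : ∀ {N} {M : Matroid N} (e f : Fin N) → genPoly {M = M} (linear e f) ≡ toPoly (linearGenₗ e f)
genPoly-linear e f = trans (cong₂ (λ x y → x ++ scale (- 1ℚ) y) (containing≡toPoly e) (containing≡toPoly f))
  (trans (cong (toPoly (containingₗ e) ++_) (scale-toPoly (- 1ℚ) (containingₗ f))) (sym (toPoly-++ (containingₗ e) (map (scaleTermₗ (- 1ℚ)) (containingₗ f)))))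

δ : ∀ {N} → Fin N → Fin N → Subset N → ℚ
δ e f X = 𝟙 (does (e ∈? X)) - 𝟙 (does (f ∈? X))

coeffₗ-linearGen : ∀ {N} (e f : Fin N) X → coeffₗ (linearGenₗ e f) X ≡ δ e f X
coeffₗ-linearGen e f X = trans (coeffₗ-++ (containingₗ e) _ X) (trans (cong₂ _+_ (coeffₗ-containing e X) (trans (coeffₗ-scale (- 1ℚ) (containingₗ f) X) (cong ((- 1ℚ) *_) (coeffₗ-containing f X))))
  (minus (𝟙 (does (e ∈? X))) (𝟙 (does (f ∈? X)))))
  where
  minus : ∀ x y → x * 1ℚ + (- 1ℚ) * (y * 1ℚ) ≡ x - y
  minus = solve-∀ ℚ-ring

-- Hypersimplex classes

γcoeff : ℕ → ℕ → ℕ → ℚ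
γcoeff n K s = ℕtoℚ (s ⊓ K) - frac (K ℕ.* s) (suc n)

γcoeff≡ : ∀ n K s → γcoeff n K s ≡ fromℕ (s ⊓ K) - fromℕ K * fromℕ s * frac 1 (suc n)
γcoeff≡ n K s = cong₂ _-_ (ℕtoℚ≡fromℕ (s ⊓ K))
  (trans (frac≡*frac1 (K ℕ.* s) (suc n) (s≤s z≤n)) (cong (_* frac 1 (suc n)) (fromℕ-* K s)))

nonemptyProper : ∀ n → List (Subset (suc n))
nonemptyProper n = filter (λ S → nonempty? S) (filter (λ S → ¬? (≡-dec Bool._≟_ S ⊤)) (allSubsets (suc n)))

γ-vanishes : ℕ → ℕ → Bool
γ-vanishes n K = (K ≡ᵇ 0) ∨ (suc n ℕ.≤ᵇ K)

γₗ : ∀ n K → LinForm (suc n)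
γₗ n K = if γ-vanishes n K then [] else map (λ S → (γcoeff n K ∣ S ∣ * 1ℚ , S)) (nonemptyProper n)

if-lin : ∀ {N} (b : Bool) (x : Poly N) (ys : LinForm N) → x ≡ toPoly ys → (if b then [] else x) ≡ toPoly (if b then [] else ys)
if-lin true x ys e = refl
if-lin false x ys e = e

γ≡toPoly-γₗ : ∀ n K → γ n K ≡ toPoly (γₗ n K)
γ≡toPoly-γₗ n K = if-lin (γ-vanishes n K) _ _ (sumₚ-scale-var≡toPoly (λ S → γcoeff n K ∣ S ∣) (nonemptyProper n))

𝟙nonemptyProper : ∀ {N} → Subset N → ℚ
𝟙nonemptyProper X = 𝟙 (does (¬? (≡-dec Bool._≟_ X ⊤))) * 𝟙 (does (nonempty? X))

coeffₗ-γₗ-nontrivial : ∀ n K X → coeffₗ (map (λ S → (γcoeff n K ∣ S ∣ * 1ℚ , S)) (nonemptyProper n)) X ≡ 𝟙nonemptyProper X * (γcoeff n K ∣ X ∣ * 1ℚ)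
coeffₗ-γₗ-nontrivial n K X = trans (∑-map (coeffOfTermₗ X) _ (nonemptyProper n))
  (trans (∑-filter (λ S → nonempty? S) _ (filter (λ S → ¬? (≡-dec Bool._≟_ S ⊤)) (allSubsets (suc n))))
  (trans (∑-cong (filter (λ S → ¬? (≡-dec Bool._≟_ S ⊤)) (allSubsets (suc n))) (λ S → sym (ℚP.*-assoc (𝟙 (does (nonempty? S))) (γcoeff n K ∣ S ∣ * 1ℚ) (𝟙 (eqᵇ X S)))))
  (trans (∑-filter-allSubsets-select (suc n) (λ S → ¬? (≡-dec Bool._≟_ S ⊤)) (λ S → 𝟙 (does (nonempty? S)) * (γcoeff n K ∣ S ∣ * 1ℚ)) X)
   (sym (ℚP.*-assoc (𝟙 (does (¬? (≡-dec Bool._≟_ X ⊤)))) (𝟙 (does (nonempty? X))) (γcoeff n K ∣ X ∣ * 1ℚ))))))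

γcoeff-0 : ∀ n s → γcoeff n 0 s ≡ 0ℚ
γcoeff-0 n s = trans (cong₂ _-_ (cong ℕtoℚ (ℕP.⊓-zeroʳ s)) (ℚP.0/n≡0 (suc n))) refl

γcoeff-N : ∀ n s → s ≤ suc n → γcoeff n (suc n) s ≡ 0ℚ
γcoeff-N n s s≤N = trans (cong₂ _-_ (trans (cong ℕtoℚ (ℕP.m≤n⇒m⊓n≡m s≤N)) (ℕtoℚ≡fromℕ s)) fr) (ℚP.+-inverseʳ (fromℕ s))
  where
  fr : frac (suc n ℕ.* s) (suc n) ≡ fromℕ s
  fr = *fromℕ-cancelʳ (suc n) (s≤s z≤n) (trans (frac*fromℕ (suc n ℕ.* s) (suc n) (s≤s z≤n)) (trans (fromℕ-* (suc n) s) (ℚP.*-comm (fromℕ (suc n)) (fromℕ s))))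

coeffₗ-γₗ-cases : ∀ n K X (b : Bool) → γ-vanishes n K ≡ b → K ≤ suc n →
  coeffₗ (if b then [] else map (λ S → (γcoeff n K ∣ S ∣ * 1ℚ , S)) (nonemptyProper n)) X ≡ 𝟙nonemptyProper X * (γcoeff n K ∣ X ∣ * 1ℚ)
coeffₗ-γₗ-cases n K X false e K≤N = coeffₗ-γₗ-nontrivial n K X
coeffₗ-γₗ-cases n zero X true e K≤N = sym (trans (cong (λ z → 𝟙nonemptyProper X * (z * 1ℚ)) (γcoeff-0 n ∣ X ∣)) (ℚP.*-zeroʳ (𝟙nonemptyProper X)))
coeffₗ-γₗ-cases n (suc K) X true e K≤N with ℕP.≤-antisym K≤N (ℕP.≤ᵇ⇒≤ (suc n) (suc K) (subst T (sym e) tt))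
... | refl = sym (trans (cong (λ z → 𝟙nonemptyProper X * (z * 1ℚ)) (γcoeff-N n ∣ X ∣ (∣p∣≤n X))) (ℚP.*-zeroʳ (𝟙nonemptyProper X)))

coeffₗ-γₗ : ∀ n K X → K ≤ suc n → Nonempty X → X ≢ ⊤ → coeffₗ (γₗ n K) X ≡ γcoeff n K ∣ X ∣
coeffₗ-γₗ n K X K≤N X≠∅ X≢⊤ =
  trans (coeffₗ-γₗ-cases n K X (γ-vanishes n K) refl K≤N)
  (trans (cong (_* (γcoeff n K ∣ X ∣ * 1ℚ)) 𝟙nonemptyProper≡1) (trans (ℚP.*-identityˡ _) (ℚP.*-identityʳ _)))
  where
  𝟙nonemptyProper≡1 : 𝟙nonemptyProper X ≡ 1ℚ
  𝟙nonemptyProper≡1 = trans (cong₂ _*_ (cong 𝟙 (dec-true (¬? (≡-dec Bool._≟_ X ⊤)) X≢⊤)) (cong 𝟙 (dec-true (nonempty? X) X≠∅)))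
                            (ℚP.*-identityˡ 1ℚ)

members nonMembers : ∀ {N} → Subset N → List (Fin N)
members {N} X = filter (λ e → e ∈? X) (allFin N)
nonMembers {N} X = filter (λ e → ¬? (e ∈? X)) (allFin N)

𝟙∈ : ∀ {N} → Fin N → Subset N → ℚ
𝟙∈ e X = 𝟙 (does (e ∈? X))

∑-members : ∀ {N} (X : Subset N) (u : Fin N → ℚ) → ∑ u (members X) ≡ ∑Fin N (λ e → 𝟙∈ e X * u e)
∑-members {N} X u = trans (∑-filter (λ e → e ∈? X) u (allFin N)) (∑-tabulate N (λ i → i) _)

∑-nonMembers : ∀ {N} (X : Subset N) (u : Fin N → ℚ) → ∑ u (nonMembers X) ≡ ∑Fin N (λ e → 𝟙 (not (does (e ∈? X))) * u e)
∑-nonMembers {N} X u = trans (∑-filter (λ e → ¬? (e ∈? X)) u (allFin N)) (∑-tabulate N (λ i → i) _)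

𝟙-not : ∀ b → 𝟙 (not b) * 1ℚ ≡ 1ℚ - 𝟙 b
𝟙-not true = refl
𝟙-not false = refl

∑1-members : ∀ {N} (X : Subset N) → ∑ (λ _ → 1ℚ) (members X) ≡ fromℕ (∣ X ∣)
∑1-members {N} X = trans (∑-members X _) (trans (∑Fin-cong N (λ e → ℚP.*-identityʳ (𝟙∈ e X))) (∑Fin-𝟙∈ N X))

∑1-nonMembers : ∀ {N} (X : Subset N) → ∑ (λ _ → 1ℚ) (nonMembers X) ≡ fromℕ N - fromℕ (∣ X ∣)
∑1-nonMembers {N} X = trans (∑-nonMembers X _) (trans (∑Fin-cong N (λ e → 𝟙-not (does (e ∈? X))))
  (trans (∑Fin-− N (λ _ → 1ℚ) (λ e → 𝟙∈ e X)) (cong₂ _-_ (∑Fin-1 N) (∑Fin-𝟙∈ N X))))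

module _ {N : ℕ} {X Y : Subset N} where
  ⊆⇒𝟙∈*𝟙∈ : X ⊆ Y → ∀ e → 𝟙∈ e X * 𝟙∈ e Y ≡ 𝟙∈ e X
  ⊆⇒𝟙∈*𝟙∈ s e with e ∈? X | e ∈? Y
  ... | yes x | yes y = refl
  ... | yes x | no y = ⊥-elim (y (s x))
  ... | no x | yes y = refl
  ... | no x | no y = refl

  ⊆⇒𝟙∉*𝟙∈ : X ⊆ Y → ∀ e → 𝟙 (not (does (e ∈? X))) * 𝟙∈ e Y ≡ 𝟙∈ e Y - 𝟙∈ e X
  ⊆⇒𝟙∉*𝟙∈ s e with e ∈? X | e ∈? Y
  ... | yes x | yes y = refl
  ... | yes x | no y = ⊥-elim (y (s x))
  ... | no x | yes y = refl
  ... | no x | no y = refl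

  ⊇⇒𝟙∈*𝟙∈ : Y ⊆ X → ∀ e → 𝟙∈ e X * 𝟙∈ e Y ≡ 𝟙∈ e Y
  ⊇⇒𝟙∈*𝟙∈ s e with e ∈? X | e ∈? Y
  ... | yes x | yes y = refl
  ... | yes x | no y = refl
  ... | no x | yes y = ⊥-elim (x (s y))
  ... | no x | no y = refl

  ⊇⇒𝟙∉*𝟙∈ : Y ⊆ X → ∀ e → 𝟙 (not (does (e ∈? X))) * 𝟙∈ e Y ≡ 0ℚ
  ⊇⇒𝟙∉*𝟙∈ s e with e ∈? X | e ∈? Y
  ... | yes x | yes y = refl
  ... | yes x | no y = refl
  ... | no x | yes y = ⊥-elim (x (s y))
  ... | no x | no y = refl

∑-const-− : ∀ {A : Set} (x : ℚ) (w : A → ℚ) Fs → ∑ (λ f → x - w f) Fs ≡ ∑ (λ _ → 1ℚ) Fs * x - ∑ w Fs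
∑-const-− x w [] = base x
  where
  base : ∀ x → 0ℚ ≡ 0ℚ * x - 0ℚ
  base = solve-∀ ℚ-ring
∑-const-− x w (f ∷ Fs) rewrite ∑-const-− x w Fs = step x (w f) (∑ (λ _ → 1ℚ) Fs) (∑ w Fs)
  where
  step : ∀ x y s t → x - y + (s * x - t) ≡ (1ℚ + s) * x - (y + t)
  step = solve-∀ ℚ-ring

∑∑-− : ∀ {A : Set} (u w : A → ℚ) Es Fs →
  ∑ (λ e → ∑ (λ f → u e - w f) Fs) Es ≡ ∑ (λ _ → 1ℚ) Fs * ∑ u Es - ∑ (λ _ → 1ℚ) Es * ∑ w Fs
∑∑-− u w [] Fs = base (∑ (λ _ → 1ℚ) Fs) (∑ w Fs)
  where
  base : ∀ a b → 0ℚ ≡ a * 0ℚ - 0ℚ * b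
  base = solve-∀ ℚ-ring
∑∑-− u w (e ∷ Es) Fs rewrite ∑-const-− (u e) w Fs | ∑∑-− u w Es Fs =
  step (∑ (λ _ → 1ℚ) Fs) (u e) (∑ w Fs) (∑ u Es) (∑ (λ _ → 1ℚ) Es)
  where
  step : ∀ F x W U E → F * x - W + (F * U - E * W) ≡ F * (x + U) - (1ℚ + E) * W
  step = solve-∀ ℚ-ring

Ψ : ∀ {N} → Subset N → Subset N → ℚ
Ψ X Y = ∑ (λ e → ∑ (λ f → δ e f Y) (nonMembers X)) (members X)

Ψ≡ : ∀ {N} (X Y : Subset N) → Ψ X Y ≡ ∑ (λ _ → 1ℚ) (nonMembers X) * ∑ (λ e → 𝟙∈ e Y) (members X) - ∑ (λ _ → 1ℚ) (members X) * ∑ (λ f → 𝟙∈ f Y) (nonMembers X)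
Ψ≡ X Y = ∑∑-− (λ e → 𝟙∈ e Y) (λ f → 𝟙∈ f Y) (members X) (nonMembers X)

Ψ-⊆ : ∀ {N} (X Y : Subset N) → X ⊆ Y → Ψ X Y ≡ fromℕ ∣ X ∣ * fromℕ N - fromℕ ∣ X ∣ * fromℕ ∣ Y ∣
Ψ-⊆ {N} X Y X⊆Y = trans (Ψ≡ X Y) (trans (cong₂ _-_ (cong₂ _*_ (∑1-nonMembers X)
    (trans (∑-members X _) (trans (∑Fin-cong N (⊆⇒𝟙∈*𝟙∈ X⊆Y)) (∑Fin-𝟙∈ N X))))
  (cong₂ _*_ (∑1-members X) (trans (∑-nonMembers X _) (trans (∑Fin-cong N (⊆⇒𝟙∉*𝟙∈ X⊆Y)) (trans (∑Fin-− N _ _) (cong₂ _-_ (∑Fin-𝟙∈ N Y) (∑Fin-𝟙∈ N X)))))))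
  (regroup (fromℕ N) (fromℕ ∣ X ∣) (fromℕ ∣ Y ∣)))
  where
  regroup : ∀ n x y → (n - x) * x - x * (y - x) ≡ x * n - x * y
  regroup = solve-∀ ℚ-ring

Ψ-⊇ : ∀ {N} (X Y : Subset N) → Y ⊆ X → Ψ X Y ≡ fromℕ ∣ Y ∣ * fromℕ N - fromℕ ∣ X ∣ * fromℕ ∣ Y ∣
Ψ-⊇ {N} X Y Y⊆X = trans (Ψ≡ X Y) (trans (cong₂ _-_ (cong₂ _*_ (∑1-nonMembers X)
    (trans (∑-members X _) (trans (∑Fin-cong N (⊇⇒𝟙∈*𝟙∈ Y⊆X)) (∑Fin-𝟙∈ N Y))))
  (cong₂ _*_ (∑1-members X) (trans (∑-nonMembers X _) (trans (∑Fin-cong N (⊇⇒𝟙∉*𝟙∈ Y⊆X)) (∑Fin-zero N)))))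
  (regroup (fromℕ N) (fromℕ ∣ X ∣) (fromℕ ∣ Y ∣)))
  where
  ∑Fin-zero : ∀ N → ∑Fin N (λ _ → 0ℚ) ≡ 0ℚ
  ∑Fin-zero zero = refl
  ∑Fin-zero (suc N) = trans (ℚP.+-identityˡ _) (∑Fin-zero N)
  regroup : ∀ n x y → (n - x) * y - x * 0ℚ ≡ y * n - x * y
  regroup = solve-∀ ℚ-ring

-- Matroids and the Chow ideal

module MatroidFacts {N : ℕ} (M : Matroid N) where

  ∈⇒⁅⁆⊆ : ∀ {x} {A : Subset N} → x ∈ A → ⁅ x ⁆ ⊆ A
  ∈⇒⁅⁆⊆ {x} {A} x∈A {y} y∈ = subst (_∈ A) (sym (x∈⁅y⁆⇒x≡y x y∈)) x∈A

  rk-⁅⁆ : IsSimple M → ∀ e → rk M ⁅ e ⁆ ≡ 1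
  rk-⁅⁆ simp e = trans (cong (rk M) (sym (∪-idem ⁅ e ⁆))) (trans (simp e e) (trans (cong ∣_∣ (∪-idem ⁅ e ⁆)) (∣⁅x⁆∣≡1 e)))

  rk-∪⁅⁆≤ : ∀ (X : Subset N) e → rk M (X ∪ ⁅ e ⁆) ≤ suc (rk M X)
  rk-∪⁅⁆≤ X e = ℕP.≤-trans (ℕP.m≤m+n (rk M (X ∪ ⁅ e ⁆)) (rk M (X ∩ ⁅ e ⁆)))
    (ℕP.≤-trans (rk-submod M X ⁅ e ⁆) (ℕP.≤-trans (ℕP.+-monoʳ-≤ (rk M X) (ℕP.≤-trans (rk-bound M ⁅ e ⁆) (ℕP.≤-reflexive (∣⁅x⁆∣≡1 e))))
      (ℕP.≤-reflexive (ℕP.+-comm (rk M X) 1))))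

  ≢⊤⇒∃∉ : ∀ (A : Subset N) → A ≢ ⊤ → ∃ λ e → e ∉ A
  ≢⊤⇒∃∉ A ne = ¬∀⟶∃¬ N (λ e → e ∈ A) (λ e → e ∈? A) (λ all → ne (⊆-antisym ⊆⊤ (λ {x} _ → all x)))

  NEPFlat-rk-bounds : ∀ r → IsSimple M → rank M ≡ suc r → ∀ A → NEPFlat M A → (1 ≤ rk M A) × (rk M A ≤ r)
  NEPFlat-rk-bounds r simp rnk A (A-flat , (x , x∈A) , A≢⊤) =
    ℕP.≤-trans (ℕP.≤-reflexive (sym (rk-⁅⁆ simp x))) (rk-mono M ⁅ x ⁆ A (∈⇒⁅⁆⊆ x∈A)) ,
    (let (e , e∉A) = ≢⊤⇒∃∉ A A≢⊤ in
      ℕP.≤-pred (ℕP.≤-trans (A-flat e e∉A) (ℕP.≤-trans (rk-mono M _ ⊤ ⊆⊤) (ℕP.≤-reflexive rnk))))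

  ∣∣<∣∪⁅⁆∣ : ∀ (X : Subset N) e → e ∉ X → ∣ X ∣ < ∣ X ∪ ⁅ e ⁆ ∣
  ∣∣<∣∪⁅⁆∣ X e e∉X = p⊂q⇒∣p∣<∣q∣ (p⊆p∪q ⁅ e ⁆ , e , q⊆p∪q X ⁅ e ⁆ (x∈⁅x⁆ e) , e∉X)

  extendToMaximal : ∀ r f (X : Subset N) → rk M X ≤ r → N ≤ ∣ X ∣ ℕ.+ f → ∃ λ H → (rk M H ≤ r) × (∀ e → e ∉ H → r < rk M (H ∪ ⁅ e ⁆))
  extendToMaximal r f X h b with any? (λ e → (¬? (e ∈? X)) ×-dec (rk M (X ∪ ⁅ e ⁆) ℕ.≤? r))
  ... | no ¬∃ = X , h , λ e e∉X → ℕP.≰⇒> (λ le → ¬∃ (e , e∉X , le))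
  extendToMaximal r zero X h b | yes (e , e∉X , le) =
    ⊥-elim (e∉X (subst (e ∈_) (sym (∣p∣≡n⇒p≡⊤ (ℕP.≤-antisym (∣p∣≤n X) (ℕP.≤-trans b (ℕP.≤-reflexive (ℕP.+-identityʳ _)))))) ∈⊤))
  extendToMaximal r (suc f) X h b | yes (e , e∉X , le) = extendToMaximal r f (X ∪ ⁅ e ⁆) le
    (ℕP.≤-trans b (ℕP.≤-trans (ℕP.≤-reflexive (ℕP.+-suc ∣ X ∣ f)) (ℕP.+-monoˡ-≤ f (∣∣<∣∪⁅⁆∣ X e e∉X))))

  ∃-hyperplane : ∀ r → rank M ≡ suc r → ∃ λ H → IsFlat M H × (rk M H ≡ r) × (H ≢ ⊤)
  ∃-hyperplane r rnk with extendToMaximal r N ⊥ (ℕP.≤-trans (rk-bound M ⊥) (ℕP.≤-trans (ℕP.≤-reflexive (∣⊥∣≡0 N)) z≤n)) (ℕP.≤-reflexive (sym (cong (ℕ._+ N) (∣⊥∣≡0 N))))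
  ... | (H , h1 , h2) = H , H-flat , rk-H , H≢⊤
    where
    H≢⊤ : H ≢ ⊤
    H≢⊤ refl = ℕP.n≮n r (subst (_≤ r) rnk h1)
    rk-H : rk M H ≡ r
    rk-H = let (e , e∉H) = ≢⊤⇒∃∉ H H≢⊤ in ℕP.≤-antisym h1 (ℕP.≤-pred (ℕP.≤-trans (h2 e e∉H) (rk-∪⁅⁆≤ H e)))
    H-flat : IsFlat M H
    H-flat e e∉H = ℕP.≤-<-trans h1 (h2 e e∉H)

All-concatMap⁺ : ∀ {A B : Set} {P : B → Set} {f : A → List B} → (∀ x → All P (f x)) → ∀ xs → All P (concatMap f xs)
All-concatMap⁺ h xs = concat⁺ (map⁺ (universal h xs))

-- A monomial x_S x_T is a multiple of a generator unless S and T are comparable nonempty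
-- proper flats, so a quadratic polynomial is in the ideal once those coefficients vanish.
module QuadraticIdeal {N : ℕ} (M : Matroid N) where

  IdealTerm : Set
  IdealTerm = ℚ × Monomial N × Gen M

  termPoly : IdealTerm → Poly N
  termPoly (c , m , g) = ((c , m) ∷ []) *ₚ genPoly g

  coeff-sum-map : ∀ (φ : IdealTerm → Poly N) cs mm → (∀ c m g → coeff (φ (c , m , g)) mm ≡ coeff (termPoly (c , m , g)) mm) →
     coeff (sumₚ (map φ cs)) mm ≡ ∑ (λ t → coeff (termPoly t) mm) cs
  coeff-sum-map φ [] mm h = refl
  coeff-sum-map φ ((c , m , g) ∷ cs) mm h = trans (coeff-++ (φ (c , m , g)) _ mm) (cong₂ _+_ (h c m g) (coeff-sum-map φ cs mm h))

  InIdeal-intro : ∀ (p : Poly N) cs → (∀ mm → coeff p mm ≡ ∑ (λ t → coeff (termPoly t) mm) cs) → InIdeal M p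
  InIdeal-intro p cs h = cs , λ mm → trans (h mm) (sym (coeff-sum-map _ cs mm (λ c m g → refl)))

  Quadratic : ℚ × Monomial N → Set
  Quadratic (c , m) = ∃ λ S → ∃ λ T → m ≡ S ∷ T ∷ []

  isFlat? : ∀ F → Dec (IsFlat M F)
  isFlat? F = all? (λ e → ¬? (e ∈? F) →-dec (rk M F ℕ.<? rk M (F ∪ ⁅ e ⁆)))

  nepFlat? : ∀ F → Dec (NEPFlat M F)
  nepFlat? F = isFlat? F ×-dec (nonempty? F ×-dec ¬? (≡-dec Bool._≟_ F ⊤))

  ComparableFlats : Subset N → Subset N → Set
  ComparableFlats S T = NEPFlat M S × NEPFlat M T × ((S ⊆ T) ⊎ (T ⊆ S))

  comparableFlats? : ∀ S T → Dec (ComparableFlats S T)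
  comparableFlats? S T = nepFlat? S ×-dec (nepFlat? T ×-dec ((S ⊆? T) ⊎-dec (T ⊆? S)))

  ComparableFlats-sym : ∀ {S T} → ComparableFlats S T → ComparableFlats T S
  ComparableFlats-sym (a , b , inj₁ x) = b , a , inj₂ x
  ComparableFlats-sym (a , b , inj₂ x) = b , a , inj₁ x

  killTerm : ∀ c S T → ¬ ComparableFlats S T → IdealTerm
  killTerm c S T ng with nepFlat? S
  ... | no nS = (c , T ∷ [] , nonflat S nS)
  ... | yes fS with nepFlat? T
  ...   | no nT = (c , S ∷ [] , nonflat T nT)
  ...   | yes fT = (c , [] , incomp S T fS fT (λ s → ng (fS , fT , inj₁ s)) (λ s → ng (fS , fT , inj₂ s)))

  killTerm-coeff : ∀ c S T ng mm → coeff (termPoly (killTerm c S T ng)) mm ≡ c * 𝟙 (sameMon mm (S ∷ T ∷ []))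
  killTerm-coeff c S T ng mm with nepFlat? S
  ... | no nS = trans (ℚP.+-identityʳ _) (trans (if-0≡*𝟙 (sameMon mm (T ∷ S ∷ [])) (c * 1ℚ))
        (cong₂ (λ x y → x * 𝟙 y) (ℚP.*-identityʳ c) (sameMon-respʳ mm (swap≈ₘ T S))))
  ... | yes fS with nepFlat? T
  ...   | no nT = trans (ℚP.+-identityʳ _) (trans (if-0≡*𝟙 (sameMon mm (S ∷ T ∷ [])) (c * 1ℚ))
        (cong (λ x → x * 𝟙 (sameMon mm (S ∷ T ∷ []))) (ℚP.*-identityʳ c)))
  ...   | yes fT = trans (ℚP.+-identityʳ _) (trans (if-0≡*𝟙 (sameMon mm (S ∷ T ∷ [])) (c * (1ℚ * 1ℚ)))
        (cong (λ x → x * 𝟙 (sameMon mm (S ∷ T ∷ []))) (ℚP.*-identityʳ c)))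

  killTerms : (D : Poly N) → All Quadratic D → List IdealTerm
  killTerms [] [] = []
  killTerms ((c , m) ∷ D) ((S , T , refl) ∷ qs) with comparableFlats? S T
  ... | yes _ = killTerms D qs
  ... | no ng = killTerm c S T ng ∷ killTerms D qs

  comparablePart : (D : Poly N) → All Quadratic D → Monomial N → ℚ
  comparablePart [] [] mm = 0ℚ
  comparablePart ((c , m) ∷ D) ((S , T , refl) ∷ qs) mm with comparableFlats? S T
  ... | yes _ = c * 𝟙 (sameMon mm (S ∷ T ∷ [])) + comparablePart D qs mm
  ... | no _ = comparablePart D qs mm

  private
    +-swapˡ : ∀ x a b → x + (a + b) ≡ a + (x + b)
    +-swapˡ = solve-∀ ℚ-ring

  coeff-split : ∀ D qs mm → coeff D mm ≡ ∑ (λ t → coeff (termPoly t) mm) (killTerms D qs) + comparablePart D qs mm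
  coeff-split [] [] mm = refl
  coeff-split ((c , m) ∷ D) ((S , T , refl) ∷ qs) mm with comparableFlats? S T
  ... | yes g = trans (cong₂ _+_ (if-0≡*𝟙 (sameMon mm (S ∷ T ∷ [])) c) (coeff-split D qs mm))
        (+-swapˡ (c * 𝟙 (sameMon mm (S ∷ T ∷ []))) (∑ (λ t → coeff (termPoly t) mm) (killTerms D qs)) (comparablePart D qs mm))
  ... | no ng = trans (cong₂ _+_ (if-0≡*𝟙 (sameMon mm (S ∷ T ∷ [])) c) (coeff-split D qs mm))
        (trans (sym (ℚP.+-assoc (c * 𝟙 (sameMon mm (S ∷ T ∷ []))) (∑ (λ t → coeff (termPoly t) mm) (killTerms D qs)) (comparablePart D qs mm)))
          (cong (λ z → z + ∑ (λ t → coeff (termPoly t) mm) (killTerms D qs) + comparablePart D qs mm) (sym (killTerm-coeff c S T ng mm))))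

  ComparableFlats-resp-sameMon : ∀ {S0 T0 S T} → ComparableFlats S0 T0 → sameMon (S0 ∷ T0 ∷ []) (S ∷ T ∷ []) ≡ true → ComparableFlats S T
  ComparableFlats-resp-sameMon {S0} {T0} {S} {T} g e with ∨-elim (eqᵇ S0 S ∧ eqᵇ T0 T) (trans (sym (sameMon-pair S0 T0 S T)) e)
  ... | inj₁ p = subst₂ ComparableFlats (eqᵇ⇒≡ {X = S0} {Y = S} (∧-trueˡ p)) (eqᵇ⇒≡ {X = T0} {Y = T} (∧-trueʳ {eqᵇ S0 S} p)) g
  ... | inj₂ p = subst₂ ComparableFlats (eqᵇ⇒≡ {X = T0} {Y = S} (∧-trueʳ {eqᵇ S0 T} p)) (eqᵇ⇒≡ {X = S0} {Y = T} (∧-trueˡ p)) (ComparableFlats-sym g)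

  comparablePart-at-comparable : ∀ D qs mm S0 T0 → ComparableFlats S0 T0 → sameMon mm (S0 ∷ T0 ∷ []) ≡ true → comparablePart D qs mm ≡ coeff D (S0 ∷ T0 ∷ [])
  comparablePart-at-comparable [] [] mm S0 T0 g e = refl
  comparablePart-at-comparable ((c , m) ∷ D) ((S , T , refl) ∷ qs) mm S0 T0 g0 e with comparableFlats? S T
  ... | yes g = cong₂ _+_ (trans (cong (λ b → c * 𝟙 b) (sameMon-respˡ (S ∷ T ∷ []) (sameMon-sound mm _ e)))
                   (sym (if-0≡*𝟙 (sameMon (S0 ∷ T0 ∷ []) (S ∷ T ∷ [])) c))) (comparablePart-at-comparable D qs mm S0 T0 g0 e)
  ... | no ng with sameMon (S0 ∷ T0 ∷ []) (S ∷ T ∷ []) in e2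
  ...   | true = ⊥-elim (ng (ComparableFlats-resp-sameMon g0 e2))
  ...   | false = trans (comparablePart-at-comparable D qs mm S0 T0 g0 e) (sym (ℚP.+-identityˡ _))

  comparablePart-cases : ∀ D qs mm → (∃ λ S0 → ∃ λ T0 → ComparableFlats S0 T0 × (sameMon mm (S0 ∷ T0 ∷ []) ≡ true)) ⊎ (comparablePart D qs mm ≡ 0ℚ)
  comparablePart-cases [] [] mm = inj₂ refl
  comparablePart-cases ((c , m) ∷ D) ((S , T , refl) ∷ qs) mm with comparableFlats? S T
  ... | no ng = comparablePart-cases D qs mm
  ... | yes g with sameMon mm (S ∷ T ∷ []) in e
  ...   | true = inj₁ (S , T , g , e)
  ...   | false with comparablePart-cases D qs mm
  ...     | inj₁ x = inj₁ x
  ...     | inj₂ z = inj₂ (trans (cong₂ _+_ (ℚP.*-zeroʳ c) z) refl)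

  coeff≡killTerms : ∀ D (qs : All Quadratic D) → (∀ S T → ComparableFlats S T → coeff D (S ∷ T ∷ []) ≡ 0ℚ) →
    ∀ mm → coeff D mm ≡ ∑ (λ t → coeff (termPoly t) mm) (killTerms D qs)
  coeff≡killTerms D qs h mm = trans (coeff-split D qs mm) (trans (cong (∑ (λ t → coeff (termPoly t) mm) (killTerms D qs) +_) comparablePart≡0) (ℚP.+-identityʳ _))
    where
    comparablePart≡0 : comparablePart D qs mm ≡ 0ℚ
    comparablePart≡0 with comparablePart-cases D qs mm
    ... | inj₁ (S0 , T0 , g , e) = trans (comparablePart-at-comparable D qs mm S0 T0 g e) (h S0 T0 g)
    ... | inj₂ z = z

  Quadratic-map-toPoly : ∀ (G : ℚ × Monomial N → ℚ × Monomial N) (qs : LinForm N) rest →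
    (∀ b T → Quadratic (G (b , T ∷ []))) → All Quadratic rest → All Quadratic (map G (toPoly qs) ++ rest)
  Quadratic-map-toPoly G [] rest h r = r
  Quadratic-map-toPoly G ((b , T) ∷ qs) rest h r = h b T ∷ Quadratic-map-toPoly G qs rest h r

  Quadratic-toPoly-*ₚ : ∀ (ps qs : LinForm N) → All Quadratic (toPoly ps *ₚ toPoly qs)
  Quadratic-toPoly-*ₚ [] qs = []
  Quadratic-toPoly-*ₚ ((a , S) ∷ ps) qs = Quadratic-map-toPoly _ qs _ (λ b T → S , T , refl) (Quadratic-toPoly-*ₚ ps qs)

  Quadratic-scale : ∀ a (p : Poly N) → All Quadratic p → All Quadratic (scale a p)
  Quadratic-scale a [] [] = []
  Quadratic-scale a ((c , m) ∷ p) (q ∷ qs) = q ∷ Quadratic-scale a p qs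

𝟙≟-no : ∀ {a k} → a ≢ k → 𝟙 (does (a ℕ.≟ k)) ≡ 0ℚ
𝟙≟-no {a} {k} a≢k = cong 𝟙 (dec-false (a ℕ.≟ k) a≢k)

𝟙≟-yes : ∀ k → 𝟙 (does (k ℕ.≟ k)) ≡ 1ℚ
𝟙≟-yes k = cong 𝟙 (dec-true (k ℕ.≟ k) refl)

𝟙≟*-cong : ∀ {k} a {x y : ℚ} → (a ≡ k → x ≡ y) → 𝟙 (does (a ℕ.≟ k)) * x ≡ 𝟙 (does (a ℕ.≟ k)) * y
𝟙≟*-cong {k} a {x} {y} h with a ℕ.≟ k
... | yes a≡k = cong (𝟙 (does (a ℕ.≟ k)) *_) (h a≡k)
... | no a≢k = begin
  𝟙 (does (a ℕ.≟ k)) * x   ≡⟨ cong (_* x) (𝟙≟-no a≢k) ⟩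
  0ℚ * x                   ≡⟨ ℚP.*-zeroˡ x ⟩
  0ℚ                       ≡⟨ sym (ℚP.*-zeroˡ y) ⟩
  0ℚ * y                   ≡⟨ cong (_* y) (sym (𝟙≟-no a≢k)) ⟩
  𝟙 (does (a ℕ.≟ k)) * y   ∎

OutsideGaps : ℕ → ℕ → ℕ → ℕ → Set
OutsideGaps m k p s = s ≤ m ⊎ s ≡ k ⊎ p ≤ s

module Interpolation (n m k p : ℕ) (m<k : m < k) (k<p : k < p) where

  α β : ℚ
  α = frac (k ∸ m) (p ∸ m)
  β = frac (p ∸ k) (p ∸ m)

  e : ℕ → ℚ
  e s = γcoeff n k s - (α * γcoeff n p s + β * γcoeff n m s)

  V : ℚ
  V = e k * frac 1 (suc n)

  private
    m≤k : m ≤ k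
    m≤k = ℕP.<⇒≤ m<k

    k≤p : k ≤ p
    k≤p = ℕP.<⇒≤ k<p

    m<p : m < p
    m<p = ℕP.<-trans m<k k<p

    0<p∸m : 0 < p ∸ m
    0<p∸m = ℕP.m<n⇒0<n∸m m<p

    D : ℚ
    D = fromℕ (p ∸ m)

    D≡ : D ≡ fromℕ p - fromℕ m
    D≡ = fromℕ-∸ p m (ℕP.<⇒≤ m<p)

    αD≡ : α * D ≡ fromℕ k - fromℕ m
    αD≡ = trans (frac*fromℕ (k ∸ m) (p ∸ m) 0<p∸m) (fromℕ-∸ k m m≤k)

    βD≡ : β * D ≡ fromℕ p - fromℕ k
    βD≡ = trans (frac*fromℕ (p ∸ k) (p ∸ m) 0<p∸m) (fromℕ-∸ p k k≤p)

  α+β≡1 : α + β ≡ 1ℚ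
  α+β≡1 = *fromℕ-cancelʳ (p ∸ m) 0<p∸m (begin
      (α + β) * D                                 ≡⟨ ℚP.*-distribʳ-+ D α β ⟩
      α * D + β * D                               ≡⟨ cong₂ _+_ αD≡ βD≡ ⟩
      (fromℕ k - fromℕ m) + (fromℕ p - fromℕ k)   ≡⟨ telescope (fromℕ m) (fromℕ k) (fromℕ p) ⟩
      1ℚ * (fromℕ p - fromℕ m)                    ≡⟨ cong (1ℚ *_) (sym D≡) ⟩
      1ℚ * D                                      ∎)
    where
    telescope : ∀ a b c → (b - a) + (c - b) ≡ 1ℚ * (c - a)
    telescope = solve-∀ ℚ-ring

  αp+βm≡k : α * fromℕ p + β * fromℕ m ≡ fromℕ k
  αp+βm≡k = *fromℕ-cancelʳ (p ∸ m) 0<p∸m (begin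
      (α * fromℕ p + β * fromℕ m) * D                                   ≡⟨ regroup α β (fromℕ p) (fromℕ m) D ⟩
      (α * D) * fromℕ p + (β * D) * fromℕ m                             ≡⟨ cong₂ (λ x y → x * fromℕ p + y * fromℕ m) αD≡ βD≡ ⟩
      (fromℕ k - fromℕ m) * fromℕ p + (fromℕ p - fromℕ k) * fromℕ m     ≡⟨ expand (fromℕ m) (fromℕ k) (fromℕ p) ⟩
      fromℕ k * (fromℕ p - fromℕ m)                                     ≡⟨ cong (fromℕ k *_) (sym D≡) ⟩
      fromℕ k * D                                                       ∎)
    where
    regroup : ∀ a b x y d → (a * x + b * y) * d ≡ (a * d) * x + (b * d) * y
    regroup = solve-∀ ℚ-ring
    expand : ∀ a b c → (b - a) * c + (c - b) * a ≡ b * (c - a)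
    expand = solve-∀ ℚ-ring

  e≡ : ∀ s → e s ≡ fromℕ (s ⊓ k) - (α * fromℕ (s ⊓ p) + β * fromℕ (s ⊓ m))
  e≡ s = begin
      e s
        ≡⟨ cong₂ _-_ (γcoeff≡ n k s) (cong₂ (λ u w → α * u + β * w) (γcoeff≡ n p s) (γcoeff≡ n m s)) ⟩
      (fromℕ (s ⊓ k) - fromℕ k * fromℕ s * frac 1 (suc n))
        - (α * (fromℕ (s ⊓ p) - fromℕ p * fromℕ s * frac 1 (suc n)) + β * (fromℕ (s ⊓ m) - fromℕ m * fromℕ s * frac 1 (suc n)))
        ≡⟨ cong (λ z → (fromℕ (s ⊓ k) - z * fromℕ s * frac 1 (suc n))
                         - (α * (fromℕ (s ⊓ p) - fromℕ p * fromℕ s * frac 1 (suc n)) + β * (fromℕ (s ⊓ m) - fromℕ m * fromℕ s * frac 1 (suc n))))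
                (sym αp+βm≡k) ⟩
      (fromℕ (s ⊓ k) - (α * fromℕ p + β * fromℕ m) * fromℕ s * frac 1 (suc n))
        - (α * (fromℕ (s ⊓ p) - fromℕ p * fromℕ s * frac 1 (suc n)) + β * (fromℕ (s ⊓ m) - fromℕ m * fromℕ s * frac 1 (suc n)))
        ≡⟨ collapse α β (fromℕ (s ⊓ k)) (fromℕ (s ⊓ p)) (fromℕ (s ⊓ m)) (fromℕ p) (fromℕ m) (fromℕ s) (frac 1 (suc n)) ⟩
      fromℕ (s ⊓ k) - (α * fromℕ (s ⊓ p) + β * fromℕ (s ⊓ m)) ∎
    where
    collapse : ∀ a b x y z P M S I →
      (x - (a * P + b * M) * S * I) - (a * (y - P * S * I) + b * (z - M * S * I)) ≡ x - (a * y + b * z)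
    collapse = solve-∀ ℚ-ring

  private
    interpolation-cong : ∀ {a b c x y z} → a ≡ x → b ≡ y → c ≡ z →
      fromℕ a - (α * fromℕ b + β * fromℕ c) ≡ fromℕ x - (α * fromℕ y + β * fromℕ z)
    interpolation-cong refl refl refl = refl

  e-≤m : ∀ s → s ≤ m → e s ≡ 0ℚ
  e-≤m s s≤m = begin
      e s
        ≡⟨ e≡ s ⟩
      fromℕ (s ⊓ k) - (α * fromℕ (s ⊓ p) + β * fromℕ (s ⊓ m))
        ≡⟨ interpolation-cong (ℕP.m≤n⇒m⊓n≡m (ℕP.≤-trans s≤m m≤k)) (ℕP.m≤n⇒m⊓n≡m (ℕP.≤-trans s≤m (ℕP.<⇒≤ m<p)))
                              (ℕP.m≤n⇒m⊓n≡m s≤m) ⟩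
      fromℕ s - (α * fromℕ s + β * fromℕ s)
        ≡⟨ cong (λ z → fromℕ s - z) (sym (ℚP.*-distribʳ-+ (fromℕ s) α β)) ⟩
      fromℕ s - (α + β) * fromℕ s
        ≡⟨ cong (λ c → fromℕ s - c * fromℕ s) α+β≡1 ⟩
      fromℕ s - 1ℚ * fromℕ s
        ≡⟨ cong (λ z → fromℕ s - z) (ℚP.*-identityˡ (fromℕ s)) ⟩
      fromℕ s - fromℕ s
        ≡⟨ ℚP.+-inverseʳ (fromℕ s) ⟩
      0ℚ ∎

  e-≥p : ∀ s → p ≤ s → e s ≡ 0ℚ
  e-≥p s p≤s = begin
      e s
        ≡⟨ e≡ s ⟩
      fromℕ (s ⊓ k) - (α * fromℕ (s ⊓ p) + β * fromℕ (s ⊓ m))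
        ≡⟨ interpolation-cong (ℕP.m≥n⇒m⊓n≡n (ℕP.≤-trans k≤p p≤s)) (ℕP.m≥n⇒m⊓n≡n p≤s)
                              (ℕP.m≥n⇒m⊓n≡n (ℕP.≤-trans (ℕP.<⇒≤ m<p) p≤s)) ⟩
      fromℕ k - (α * fromℕ p + β * fromℕ m)
        ≡⟨ cong (λ z → fromℕ k - z) αp+βm≡k ⟩
      fromℕ k - fromℕ k
        ≡⟨ ℚP.+-inverseʳ (fromℕ k) ⟩
      0ℚ ∎

  e≡𝟙*e : ∀ s → OutsideGaps m k p s → e s ≡ 𝟙 (does (s ℕ.≟ k)) * e k
  e≡𝟙*e s (inj₁ s≤m) =
    trans (e-≤m s s≤m) (sym (trans (cong (_* e k) (𝟙≟-no {s} {k} λ { refl → ℕP.<⇒≱ m<k s≤m })) (ℚP.*-zeroˡ (e k))))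
  e≡𝟙*e s (inj₂ (inj₁ refl)) = sym (trans (cong (_* e k) (𝟙≟-yes k)) (ℚP.*-identityˡ (e k)))
  e≡𝟙*e s (inj₂ (inj₂ p≤s)) =
    trans (e-≥p s p≤s) (sym (trans (cong (_* e k) (𝟙≟-no {s} {k} λ { refl → ℕP.<⇒≱ k<p p≤s })) (ℚP.*-zeroˡ (e k))))

  γcoeff*e : ∀ s → γcoeff n k s * e k ≡ V * (fromℕ (s ⊓ k) * fromℕ (suc n) - fromℕ k * fromℕ s)
  γcoeff*e s = begin
      γcoeff n k s * e k
        ≡⟨ cong (_* e k) (γcoeff≡ n k s) ⟩
      (fromℕ (s ⊓ k) - fromℕ k * fromℕ s * frac 1 (suc n)) * e k
        ≡⟨ split (fromℕ (s ⊓ k)) (fromℕ k * fromℕ s) (frac 1 (suc n)) (e k) ⟩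
      fromℕ (s ⊓ k) * e k * 1ℚ - fromℕ k * fromℕ s * frac 1 (suc n) * e k
        ≡⟨ cong (λ u → fromℕ (s ⊓ k) * e k * u - fromℕ k * fromℕ s * frac 1 (suc n) * e k) (sym (fromℕ*frac1≡1 (suc n) (s≤s z≤n))) ⟩
      fromℕ (s ⊓ k) * e k * (fromℕ (suc n) * frac 1 (suc n)) - fromℕ k * fromℕ s * frac 1 (suc n) * e k
        ≡⟨ regroup (fromℕ (s ⊓ k)) (fromℕ k * fromℕ s) (fromℕ (suc n)) (frac 1 (suc n)) (e k) ⟩
      V * (fromℕ (s ⊓ k) * fromℕ (suc n) - fromℕ k * fromℕ s) ∎
    where
    split : ∀ x y i c → (x - y * i) * c ≡ x * c * 1ℚ - y * i * c
    split = solve-∀ ℚ-ring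
    regroup : ∀ x y N i c → x * c * (N * i) - y * i * c ≡ (c * i) * (x * N - y)
    regroup = solve-∀ ℚ-ring

module Relation (n : ℕ) (M : Matroid (suc n)) (m k p : ℕ) (m<k : m < k) (k<p : k < p) (p≤N : p ≤ suc n)
  (outsideGaps : ∀ A → NEPFlat M A → OutsideGaps m k p ∣ A ∣) where

  open Interpolation n m k p m<k k<p
  open QuadraticIdeal M

  P Q : Poly (suc n)
  P = γ n k *ₚ γ n k
  Q = scale α (γ n k *ₚ γ n p) +ₚ scale β (γ n m *ₚ γ n k)

  v : ℕ → Subset (suc n) → ℚ
  v K = coeffₗ (γₗ n K)

  E : Subset (suc n) → ℚ
  E X = v k X - (α * v p X + β * v m X)

  coeff-γ*γ : ∀ K K' A B → coeff (γ n K *ₚ γ n K') (A ∷ B ∷ []) ≡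
    (if eqᵇ A B then v K A * v K' A else v K A * v K' B + v K B * v K' A)
  coeff-γ*γ K K' A B =
    trans (cong₂ (λ x y → coeff (x *ₚ y) (A ∷ B ∷ [])) (γ≡toPoly-γₗ n K) (γ≡toPoly-γₗ n K'))
          (coeff-toPoly-*ₚ (γₗ n K) (γₗ n K') A B)

  coeff-P-Q : ∀ A B → coeff (P -ₚ Q) (A ∷ B ∷ []) ≡ (if eqᵇ A B then v k A * E A else v k A * E B + v k B * E A)
  coeff-P-Q A B =
    trans (coeff-−ₚ P Q (A ∷ B ∷ []))
    (trans (cong₂ (λ x y → x + (- 1ℚ) * y) (coeff-γ*γ k k A B)
             (trans (coeff-++ (scale α (γ n k *ₚ γ n p)) (scale β (γ n m *ₚ γ n k)) (A ∷ B ∷ []))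
               (cong₂ _+_ (trans (coeff-scale α (γ n k *ₚ γ n p) (A ∷ B ∷ [])) (cong (α *_) (coeff-γ*γ k p A B)))
                          (trans (coeff-scale β (γ n m *ₚ γ n k) (A ∷ B ∷ [])) (cong (β *_) (coeff-γ*γ m k A B))))))
           (factor (eqᵇ A B)))
    where
    factor : ∀ b →
      (if b then v k A * v k A else v k A * v k B + v k B * v k A)
        + (- 1ℚ) * (α * (if b then v k A * v p A else v k A * v p B + v k B * v p A)
                    + β * (if b then v m A * v k A else v m A * v k B + v m B * v k A))
      ≡ (if b then v k A * E A else v k A * E B + v k B * E A)
    factor true = diag (v k A) (v p A) (v m A) α β
      where
      diag : ∀ c q r a b → c * c + (- 1ℚ) * (a * (c * q) + b * (r * c)) ≡ c * (c - (a * q + b * r))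
      diag = solve-∀ ℚ-ring
    factor false = off (v k A) (v k B) (v p A) (v p B) (v m A) (v m B) α β
      where
      off : ∀ c c' q q' r r' a b →
        (c * c' + c' * c) + (- 1ℚ) * (a * (c * q' + c' * q) + b * (r * c' + r' * c))
          ≡ c * (c' - (a * q' + b * r')) + c' * (c - (a * q + b * r))
      off = solve-∀ ℚ-ring

  k≤N : k ≤ suc n
  k≤N = ℕP.≤-trans (ℕP.<⇒≤ k<p) p≤N

  m≤N : m ≤ suc n
  m≤N = ℕP.≤-trans (ℕP.<⇒≤ m<k) k≤N

  v≡γcoeff : ∀ K X → K ≤ suc n → NEPFlat M X → v K X ≡ γcoeff n K ∣ X ∣
  v≡γcoeff K X K≤N (_ , X≠∅ , X≢⊤) = coeffₗ-γₗ n K X K≤N X≠∅ X≢⊤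

  E≡ : ∀ X → NEPFlat M X → E X ≡ 𝟙 (does (∣ X ∣ ℕ.≟ k)) * e k
  E≡ X X-flat = trans
    (cong₂ _-_ (v≡γcoeff k X k≤N X-flat)
               (cong₂ (λ x y → α * x + β * y) (v≡γcoeff p X p≤N X-flat) (v≡γcoeff m X m≤N X-flat)))
    (e≡𝟙*e ∣ X ∣ (outsideGaps X X-flat))

  Triple : Set
  Triple = Subset (suc n) × Fin (suc n) × Fin (suc n)

  triples : List Triple
  triples = concatMap (λ T → concatMap (λ i → map (λ j → T , i , j) (nonMembers T)) (members T))
                      (filter (λ T → ∣ T ∣ ℕ.≟ k) (allSubsets (suc n)))

  monomialFactor linearFactor : Triple → LinForm (suc n)
  monomialFactor (T , _ , _) = (V , T) ∷ []
  linearFactor (_ , i , j) = linearGenₗ i j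

  R : Poly (suc n)
  R = concatMap (λ t → toPoly (monomialFactor t) *ₚ toPoly (linearFactor t)) triples

  certificate : List IdealTerm
  certificate = map (λ { (T , i , j) → V , T ∷ [] , linear i j }) triples

  coeff-R≡∑certificate : ∀ mm → coeff R mm ≡ ∑ (λ t → coeff (termPoly t) mm) certificate
  coeff-R≡∑certificate mm =
    trans (coeff-concatMap _ triples mm)
    (trans (∑-cong triples (λ { (T , i , j) →
             cong (λ g → coeff (toPoly ((V , T) ∷ []) *ₚ g) mm) (sym (genPoly-linear {M = M} i j)) }))
           (sym (∑-map _ _ triples)))

  W : Subset (suc n) → Subset (suc n) → ℚ
  W = bilinear monomialFactor linearFactor triples

  W≡ : ∀ X Y → W X Y ≡ 𝟙 (does (∣ X ∣ ℕ.≟ k)) * (V * Ψ X Y)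
  W≡ X Y = begin
      W X Y
        ≡⟨ ∑-concatMap _ _ sizeK ⟩
      ∑ (λ T → ∑ (λ t → coeffₗ (monomialFactor t) X * coeffₗ (linearFactor t) Y)
                 (concatMap (λ i → map (λ j → T , i , j) (nonMembers T)) (members T))) sizeK
        ≡⟨ ∑-cong sizeK (λ T → trans (∑-concatMap _ _ (members T)) (∑-cong (members T) (λ i → ∑-map _ _ (nonMembers T)))) ⟩
      ∑ (λ T → ∑ (λ i → ∑ (λ j → coeffₗ ((V , T) ∷ []) X * coeffₗ (linearGenₗ i j) Y) (nonMembers T)) (members T)) sizeK
        ≡⟨ ∑-cong sizeK (λ T → trans (∑-cong (members T) (λ i → ∑-cong (nonMembers T) (λ j →
                                        cong (coeffₗ ((V , T) ∷ []) X *_) (coeffₗ-linearGen i j Y))))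
                                     (∑∑-*ˡ (coeffₗ ((V , T) ∷ []) X) (λ i j → δ i j Y) (members T) (nonMembers T))) ⟩
      ∑ (λ T → coeffₗ ((V , T) ∷ []) X * Ψ T Y) sizeK
        ≡⟨ ∑-cong sizeK (λ T → trans (cong (_* Ψ T Y) (coeffₗ-singleton V T X)) (regroup V (𝟙 (eqᵇ X T)) (Ψ T Y))) ⟩
      ∑ (λ T → (V * Ψ T Y) * 𝟙 (eqᵇ X T)) sizeK
        ≡⟨ ∑-filter-allSubsets-select (suc n) (λ T → ∣ T ∣ ℕ.≟ k) (λ T → V * Ψ T Y) X ⟩
      𝟙 (does (∣ X ∣ ℕ.≟ k)) * (V * Ψ X Y) ∎
    where
    sizeK : List (Subset (suc n))
    sizeK = filter (λ T → ∣ T ∣ ℕ.≟ k) (allSubsets (suc n))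
    regroup : ∀ v x y → (v * x + 0ℚ) * y ≡ (v * y) * x
    regroup = solve-∀ ℚ-ring

  γcoeff*e-⊆ : ∀ A B → NEPFlat M B → A ⊆ B → ∣ A ∣ ≡ k → v k B * e k ≡ V * Ψ A B
  γcoeff*e-⊆ A B B-flat A⊆B ∣A∣≡k = begin
      v k B * e k                                          ≡⟨ cong (_* e k) (v≡γcoeff k B k≤N B-flat) ⟩
      γcoeff n k ∣ B ∣ * e k                               ≡⟨ γcoeff*e ∣ B ∣ ⟩
      V * (fromℕ (∣ B ∣ ⊓ k) * fromℕ (suc n) - fromℕ k * fromℕ ∣ B ∣)  ≡⟨ cong (λ z → V * (fromℕ z * fromℕ (suc n) - fromℕ k * fromℕ ∣ B ∣)) (ℕP.m≥n⇒m⊓n≡n k≤∣B∣) ⟩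
      V * (fromℕ k * fromℕ (suc n) - fromℕ k * fromℕ ∣ B ∣)            ≡⟨ cong (λ z → V * (fromℕ z * fromℕ (suc n) - fromℕ z * fromℕ ∣ B ∣)) (sym ∣A∣≡k) ⟩
      V * (fromℕ ∣ A ∣ * fromℕ (suc n) - fromℕ ∣ A ∣ * fromℕ ∣ B ∣)    ≡⟨ cong (V *_) (sym (Ψ-⊆ A B A⊆B)) ⟩
      V * Ψ A B                                            ∎
    where
    k≤∣B∣ : k ≤ ∣ B ∣
    k≤∣B∣ = subst (_≤ ∣ B ∣) ∣A∣≡k (p⊆q⇒∣p∣≤∣q∣ A⊆B)

  γcoeff*e-⊇ : ∀ A B → NEPFlat M A → A ⊆ B → ∣ B ∣ ≡ k → v k A * e k ≡ V * Ψ B A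
  γcoeff*e-⊇ A B A-flat A⊆B ∣B∣≡k = begin
      v k A * e k                                          ≡⟨ cong (_* e k) (v≡γcoeff k A k≤N A-flat) ⟩
      γcoeff n k ∣ A ∣ * e k                               ≡⟨ γcoeff*e ∣ A ∣ ⟩
      V * (fromℕ (∣ A ∣ ⊓ k) * fromℕ (suc n) - fromℕ k * fromℕ ∣ A ∣)  ≡⟨ cong (λ z → V * (fromℕ z * fromℕ (suc n) - fromℕ k * fromℕ ∣ A ∣)) (ℕP.m≤n⇒m⊓n≡m ∣A∣≤k) ⟩
      V * (fromℕ ∣ A ∣ * fromℕ (suc n) - fromℕ k * fromℕ ∣ A ∣)        ≡⟨ cong (λ z → V * (fromℕ ∣ A ∣ * fromℕ (suc n) - fromℕ z * fromℕ ∣ A ∣)) (sym ∣B∣≡k) ⟩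
      V * (fromℕ ∣ A ∣ * fromℕ (suc n) - fromℕ ∣ B ∣ * fromℕ ∣ A ∣)    ≡⟨ cong (V *_) (sym (Ψ-⊇ B A A⊆B)) ⟩
      V * Ψ B A                                            ∎
    where
    ∣A∣≤k : ∣ A ∣ ≤ k
    ∣A∣≤k = subst (∣ A ∣ ≤_) ∣B∣≡k (p⊆q⇒∣p∣≤∣q∣ A⊆B)

  coeff-P-Q≡coeff-R : ∀ A B → NEPFlat M A → NEPFlat M B → A ⊆ B →
    coeff (P -ₚ Q) (A ∷ B ∷ []) ≡ coeff R (A ∷ B ∷ [])
  coeff-P-Q≡coeff-R A B A-flat B-flat A⊆B = begin
      coeff (P -ₚ Q) (A ∷ B ∷ [])
        ≡⟨ coeff-P-Q A B ⟩
      (if eqᵇ A B then v k A * E A else v k A * E B + v k B * E A)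
        ≡⟨ if-cong (eqᵇ A B) diag (trans (ℚP.+-comm (v k A * E B) (v k B * E A)) (cong₂ _+_ offˡ offʳ)) ⟩
      (if eqᵇ A B then W A A else W A B + W B A)
        ≡⟨ sym (coeff-concatMap-toPoly-*ₚ monomialFactor linearFactor triples A B) ⟩
      coeff R (A ∷ B ∷ []) ∎
    where
    pull : ∀ X Y → NEPFlat M Y → v k X * E Y ≡ 𝟙 (does (∣ Y ∣ ℕ.≟ k)) * (v k X * e k)
    pull X Y Y-flat = trans (cong (v k X *_) (E≡ Y Y-flat)) (swap (v k X) (𝟙 (does (∣ Y ∣ ℕ.≟ k))) (e k))
      where
      swap : ∀ x i y → x * (i * y) ≡ i * (x * y)
      swap = solve-∀ ℚ-ring
    diag : v k A * E A ≡ W A A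
    diag = trans (pull A A A-flat) (trans (𝟙≟*-cong ∣ A ∣ (γcoeff*e-⊆ A A A-flat ⊆-refl)) (sym (W≡ A A)))
    offˡ : v k B * E A ≡ W A B
    offˡ = trans (pull B A A-flat) (trans (𝟙≟*-cong ∣ A ∣ (γcoeff*e-⊆ A B B-flat A⊆B)) (sym (W≡ A B)))
    offʳ : v k A * E B ≡ W B A
    offʳ = trans (pull A B B-flat) (trans (𝟙≟*-cong ∣ B ∣ (γcoeff*e-⊇ A B A-flat A⊆B)) (sym (W≡ B A)))

  D : Poly (suc n)
  D = (P -ₚ Q) -ₚ R

  D-vanishes : ∀ S T → ComparableFlats S T → coeff D (S ∷ T ∷ []) ≡ 0ℚ
  D-vanishes S T (S-flat , T-flat , inj₁ S⊆T) =
    trans (coeff-−ₚ (P -ₚ Q) R _) (x≡y⇒x-y≡0 (coeff-P-Q≡coeff-R S T S-flat T-flat S⊆T))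
  D-vanishes S T (S-flat , T-flat , inj₂ T⊆S) =
    trans (coeff-−ₚ (P -ₚ Q) R _)
      (x≡y⇒x-y≡0 (trans (coeff-swap (P -ₚ Q) S T) (trans (coeff-P-Q≡coeff-R T S T-flat S-flat T⊆S) (coeff-swap R T S))))

  Quadratic-γ*γ : ∀ K K' → All Quadratic (γ n K *ₚ γ n K')
  Quadratic-γ*γ K K' = subst₂ (λ x y → All Quadratic (x *ₚ y)) (sym (γ≡toPoly-γₗ n K)) (sym (γ≡toPoly-γₗ n K'))
                              (Quadratic-toPoly-*ₚ (γₗ n K) (γₗ n K'))

  Quadratic-D : All Quadratic D
  Quadratic-D =
    ++⁺ (++⁺ (Quadratic-γ*γ k k)
             (Quadratic-scale (- 1ℚ) Q (++⁺ (Quadratic-scale α _ (Quadratic-γ*γ k p)) (Quadratic-scale β _ (Quadratic-γ*γ m k)))))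
        (Quadratic-scale (- 1ℚ) R (All-concatMap⁺ (λ t → Quadratic-toPoly-*ₚ (monomialFactor t) (linearFactor t)) triples))

  P≈Q : ChowEq M P Q
  P≈Q = InIdeal-intro (P -ₚ Q) (certificate ++ killTerms D Quadratic-D) λ mm → begin
      coeff (P -ₚ Q) mm
        ≡⟨ add-sub (coeff (P -ₚ Q) mm) (coeff R mm) ⟩
      coeff R mm + (coeff (P -ₚ Q) mm + (- 1ℚ) * coeff R mm)
        ≡⟨ cong₂ _+_ (coeff-R≡∑certificate mm)
                     (trans (sym (coeff-−ₚ (P -ₚ Q) R mm)) (coeff≡killTerms D Quadratic-D D-vanishes mm)) ⟩
      ∑ (λ t → coeff (termPoly t) mm) certificate + ∑ (λ t → coeff (termPoly t) mm) (killTerms D Quadratic-D)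
        ≡⟨ sym (∑-++ _ certificate (killTerms D Quadratic-D)) ⟩
      ∑ (λ t → coeff (termPoly t) mm) (certificate ++ killTerms D Quadratic-D) ∎
    where
    add-sub : ∀ x y → x ≡ y + (x + (- 1ℚ) * y)
    add-sub = solve-∀ ℚ-ring

-- Perfect matroid designs

module PerfectDesign (n r : ℕ) (M : Matroid (suc n)) (simple : IsSimple M) (rank≡ : rank M ≡ suc r)
  (ns : ℕ → ℕ) (ns-step : ∀ j → 1 ≤ j → j < r → ns j < ns (suc j))
  (perfect : ∀ j (F : Subset (suc n)) → 1 ≤ j → j ≤ r → IsFlat M F → rk M F ≡ j → ∣ F ∣ ≡ ns j)
  (ns0 : ns 0 ≡ 0) (ns1 : ns 1 ≡ 1) (ns-top : ns (suc r) ≡ suc n) where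

  open MatroidFacts M

  ns-mono : ∀ {j} l → 1 ≤ j → j ≤ l → l ≤ r → ns j ≤ ns l
  ns-mono l 1≤j j≤l l≤r with ℕP.m≤n⇒m<n∨m≡n j≤l
  ns-mono l       1≤j j≤l l≤r | inj₂ refl = ℕP.≤-refl
  ns-mono (suc l) 1≤j _   l<r | inj₁ (s≤s j≤l) =
    ℕP.≤-trans (ns-mono l 1≤j j≤l (ℕP.<⇒≤ l<r)) (ℕP.<⇒≤ (ns-step l (ℕP.≤-trans 1≤j j≤l) l<r))

  ns-r<N : 1 ≤ r → ns r < suc n
  ns-r<N 1≤r with ∃-hyperplane r rank≡
  ... | H , H-flat , rk-H , H≢⊤ = subst (_< suc n) (perfect r H 1≤r ℕP.≤-refl H-flat rk-H)
                                        (ℕP.≤∧≢⇒< (∣p∣≤n H) (λ ∣H∣≡N → H≢⊤ (∣p∣≡n⇒p≡⊤ ∣H∣≡N)))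

  ns-pred<ns : ∀ i → 1 ≤ i → i ≤ r → ns (i ∸ 1) < ns i
  ns-pred<ns (suc zero)    _ _   = subst₂ _<_ (sym ns0) (sym ns1) (s≤s z≤n)
  ns-pred<ns (suc (suc i)) _ i<r = ns-step (suc i) (s≤s z≤n) i<r

  ns<ns-suc : ∀ i → 1 ≤ i → i ≤ r → ns i < ns (suc i)
  ns<ns-suc i 1≤i i≤r with ℕP.m≤n⇒m<n∨m≡n i≤r
  ... | inj₁ i<r  = ns-step i 1≤i i<r
  ... | inj₂ refl = subst (ns i <_) (sym ns-top) (ns-r<N 1≤i)

  ns-suc≤N : ∀ i → 1 ≤ i → i ≤ r → ns (suc i) ≤ suc n
  ns-suc≤N i 1≤i i≤r with ℕP.m≤n⇒m<n∨m≡n i≤r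
  ... | inj₁ i<r  = ℕP.<⇒≤ (ℕP.≤-<-trans (ns-mono r (s≤s z≤n) i<r ℕP.≤-refl) (ns-r<N (ℕP.≤-trans 1≤i i≤r)))
  ... | inj₂ refl = ℕP.≤-reflexive ns-top

  flat-size-outsideGaps : ∀ i → 1 ≤ i → i ≤ r → ∀ A → NEPFlat M A → OutsideGaps (ns (i ∸ 1)) (ns i) (ns (suc i)) ∣ A ∣
  flat-size-outsideGaps (suc i) _ i<r A A-flat with NEPFlat-rk-bounds r simple rank≡ A A-flat
  ... | 1≤j , j≤r with ℕ.<-cmp (rk M A) (suc i) | perfect (rk M A) A 1≤j j≤r (proj₁ A-flat) refl
  ...   | tri< (s≤s j≤i) _ _ | ∣A∣≡ns = inj₁ (subst (_≤ ns i) (sym ∣A∣≡ns) (ns-mono i 1≤j j≤i (ℕP.<⇒≤ i<r)))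
  ...   | tri≈ _ j≡i _       | ∣A∣≡ns = inj₂ (inj₁ (trans ∣A∣≡ns (cong ns j≡i)))
  ...   | tri> _ _ i<j       | ∣A∣≡ns = inj₂ (inj₂ (subst (ns (suc (suc i)) ≤_) (sym ∣A∣≡ns) (ns-mono (rk M A) (s≤s z≤n) i<j j≤r)))

lemma7p4 :
  (n r : ℕ) (M : Matroid (suc n)) →
  IsSimple M →
  rank M ≡ suc r →
  (ns : ℕ → ℕ) →
  ns 1 ≡ 1 →
  (∀ j → 1 ≤ j → j < r → ns j < ns (suc j)) →
  (∀ j (F : Subset (suc n)) → 1 ≤ j → j ≤ r → IsFlat M F → rk M F ≡ j → ∣ F ∣ ≡ ns j) →
  ns 0 ≡ 0 →
  ns (suc r) ≡ suc n →
  ∀ i → 1 ≤ i → i ≤ r →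
    ChowEq M
      (γ n (ns i) *ₚ γ n (ns i))
      (scale (frac (ns i ∸ ns (i ∸ 1)) (ns (suc i) ∸ ns (i ∸ 1))) (γ n (ns i) *ₚ γ n (ns (suc i)))
        +ₚ scale (frac (ns (suc i) ∸ ns i) (ns (suc i) ∸ ns (i ∸ 1))) (γ n (ns (i ∸ 1)) *ₚ γ n (ns i)))
lemma7p4 n r M simple rank≡ ns ns1 ns-step perfect ns0 ns-top i 1≤i i≤r =
  Relation.P≈Q n M (ns (i ∸ 1)) (ns i) (ns (suc i))
    (ns-pred<ns i 1≤i i≤r) (ns<ns-suc i 1≤i i≤r) (ns-suc≤N i 1≤i i≤r) (flat-size-outsideGaps i 1≤i i≤r)
  where open PerfectDesign n r M simple rank≡ ns ns-step perfect ns0 ns1 ns-top
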